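{- Let $\Pi$ be the 600-cell. Then $B^2(\Pi)=B(B(\Pi))$ is isomorphic to the space $S_5$ of $5\times 5$ Latin squares: its vertices correspond to the 120 permutations of $\{1,2,3,4,5\}$ (i.e. the subsets of the $5\times5$ grid meeting each row and each column in exactly one cell), and its 4-simplices correspond to the $5\times 5$ Latin squares (up to renaming of symbols), a Latin square corresponding to the five permutation sets formed by the cells carrying each symbol.
   Context: The 600-cell $\Pi$ is the boundary complex of the convex hull in $\mathbb{R}^4=\mathbb{H}$ of the 120 unit quaternions of the binary icosahedral group; it triangulates the 3-sphere with 120 vertices, 600 tetrahedra, and icosahedral vertex links. A five-coloring of a simplicial complex $X$ is a map $f$ from its vertices to $\{1,\dots,5\}$ with adjacent vertices colored differently (colorings differing by renaming colors identified). $B(X)$ is the simplicial complex whose vertices are the distinct sets $f^{ -1}(c)$ ($f$ a five-coloring, $c$ a color) and whose 4-simplices are the sets $\{f^{ -1}(1),\dots,f^{ -1}(5)\}$; $B^2(X)=B(B(X))$. The space $S_5$ of Latin squares is the simplicial complex whose vertices are the subsets of the $5\times5$ grid containing exactly one cell in each row and each column, and whose 4-simplices are the partitions of the grid into five such subsets. -}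

module Defs where

open import Level using (0ℓ)
open import Data.Bool using (Bool; true; false)
open import Data.Nat using (ℕ)
open import Data.Integer using (ℤ; +_; -_; -[1+_]) renaming (_+_ to _+ℤ_; _*_ to _*ℤ_)
open import Data.Fin using (Fin; zero; suc; _≟_)
open import Data.List using (List; []; _∷_; _++_; concatMap; map; length; lookup)
open import Data.Product using (Σ; ∃; ∃-syntax; _×_; _,_; proj₁; proj₂)
open import Relation.Nullary using (¬_; does)
open import Relation.Binary using (Setoid; IsEquivalence)
open import Relation.Binary.PropositionalEquality using (_≡_; _≢_; refl; sym; trans)
open import Function.Bundles using (Inverse; _⇔_)

-- The ring ℤ[φ], φ = (1+√5)/2, φ² = φ + 1.  (a , b) stands for a + bφ.

ℤφ : Set
ℤφ = ℤ × ℤ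

_+φ_ : ℤφ → ℤφ → ℤφ
(a , b) +φ (c , d) = (a +ℤ c , b +ℤ d)

_*φ_ : ℤφ → ℤφ → ℤφ
(a , b) *φ (c , d) = (a *ℤ c +ℤ b *ℤ d , a *ℤ d +ℤ b *ℤ c +ℤ b *ℤ d)

negφ : ℤφ → ℤφ
negφ (a , b) = (- a , - b)

0φ 1φ 2φ φ φ⁻¹ : ℤφ
0φ  = (+ 0 , + 0)
1φ  = (+ 1 , + 0)
2φ  = (+ 2 , + 0)
φ   = (+ 0 , + 1)
φ⁻¹ = (-[1+ 0 ] , + 1)          -- 1/φ = φ - 1

-- Quaternions with coordinates in ℤ[φ].  A vertex q of the 600-cell is
-- stored DOUBLED, i.e. as 2q (so all coordinates lie in ℤ[φ]).

Quat : Set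
Quat = ℤφ × ℤφ × ℤφ × ℤφ

dot : Quat → Quat → ℤφ
dot (a₀ , a₁ , a₂ , a₃) (b₀ , b₁ , b₂ , b₃) =
  (a₀ *φ b₀) +φ ((a₁ *φ b₁) +φ ((a₂ *φ b₂) +φ (a₃ *φ b₃)))

signs : ℤφ → List ℤφ
signs x = x ∷ negφ x ∷ []

typeA : List Quat
typeA = concatMap (λ s → (s , 0φ , 0φ , 0φ) ∷ (0φ , s , 0φ , 0φ)
                       ∷ (0φ , 0φ , s , 0φ) ∷ (0φ , 0φ , 0φ , s) ∷ [])
                  (signs 2φ)

typeB : List Quat
typeB = concatMap (λ a → concatMap (λ b → concatMap (λ c → map (λ d → (a , b , c , d))
          (signs 1φ)) (signs 1φ)) (signs 1φ)) (signs 1φ)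

evenPerms : ℤφ → ℤφ → ℤφ → ℤφ → List Quat
evenPerms x₀ x₁ x₂ x₃ =
    (x₀ , x₁ , x₂ , x₃) ∷ (x₀ , x₂ , x₃ , x₁) ∷ (x₀ , x₃ , x₁ , x₂)
  ∷ (x₁ , x₀ , x₃ , x₂) ∷ (x₁ , x₂ , x₀ , x₃) ∷ (x₁ , x₃ , x₂ , x₀)
  ∷ (x₂ , x₀ , x₁ , x₃) ∷ (x₂ , x₁ , x₃ , x₀) ∷ (x₂ , x₃ , x₀ , x₁)
  ∷ (x₃ , x₀ , x₂ , x₁) ∷ (x₃ , x₁ , x₀ , x₂) ∷ (x₃ , x₂ , x₁ , x₀) ∷ []

typeC : List Quat
typeC = concatMap (λ a → concatMap (λ b → concatMap (λ c → evenPerms a b c 0φ)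
          (signs φ⁻¹)) (signs 1φ)) (signs φ)

icosians : List Quat
icosians = typeA ++ typeB ++ typeC

-- Graphs with a setoid of vertices (only the adjacency relation of a
-- simplicial complex matters for five-colourings).

record Graph : Set₁ where
  field
    vertices : Setoid 0ℓ 0ℓ
  open Setoid vertices public using (_≈_) renaming (Carrier to V)
  field
    adj : V → V → Set

open Graph using (V; _≈_; adj; vertices)

FiveColouring : Graph → Set
FiveColouring G =
  Σ (V G → Fin 5) λ f →
    (∀ {u v} → _≈_ G u v → f u ≡ f v) × (∀ u v → adj G u v → f u ≢ f v)

Subset : Graph → Set
Subset G = V G → Bool

_≐_ : {G : Graph} → Subset G → Subset G → Set
_≐_ {G} S T = ∀ v → S v ≡ T v

class : (G : Graph) → FiveColouring G → Fin 5 → Subset G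
class G f c v = does (proj₁ f v ≟ c)

IsBVertex : (G : Graph) → Subset G → Set
IsBVertex G S = ∃[ f ] ∃[ c ] (_≐_ {G} S (class G f c))

BV : Graph → Set
BV G = Σ (Subset G) (IsBVertex G)

BSetoid : Graph → Setoid 0ℓ 0ℓ
BSetoid G = record
  { Carrier = BV G
  ; _≈_ = λ S T → _≐_ {G} (proj₁ S) (proj₁ T)
  ; isEquivalence = record
    { refl = λ v → refl
    ; sym = λ p v → sym (p v)
    ; trans = λ p q v → trans (p v) (q v) } }

B : Graph → Graph
B G = record
  { vertices = BSetoid G
  ; adj = λ S T → ¬ (_≐_ {G} (proj₁ S) (proj₁ T)) ×
                  (∃[ f ] ∃[ c ] ∃[ d ]
                     (_≐_ {G} (proj₁ S) (class G f c) × _≐_ {G} (proj₁ T) (class G f d)))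
  }

SameSet : (S : Setoid 0ℓ 0ℓ) → (Fin 5 → Setoid.Carrier S) → (Fin 5 → Setoid.Carrier S) → Set
SameSet S σ τ = (∀ i → ∃[ j ] (Setoid._≈_ S (σ i) (τ j)))
              × (∀ j → ∃[ i ] (Setoid._≈_ S (σ i) (τ j)))

IsBSimplex : (G : Graph) → (Fin 5 → BV G) → Set
IsBSimplex G σ = ∃[ f ] SameSet (BSetoid G) σ (λ c → class G f c , f , c , λ v → refl)

-- Vertices: the 120 icosians;
-- two are joined by an edge iff they are at the edge distance 1/φ, i.e.
-- their inner product is φ/2 (for the doubled vectors: 4·φ/2 = 2φ).

PiV : Set
PiV = Fin (length icosians)

Π600 : Graph
Π600 = record
  { vertices = Relation.Binary.PropositionalEquality.setoid PiV
  ; adj = λ u v → dot (lookup icosians u) (lookup icosians v) ≡ (+ 0 , + 2)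
  }

B²Π : Graph
B²Π = B (B Π600)

Grid : Set
Grid = Fin 5 × Fin 5          -- (row , column)

ExactlyOne : (Fin 5 → Bool) → Set
ExactlyOne P = ∃[ k ] (P k ≡ true × (∀ k' → P k' ≡ true → k' ≡ k))

IsPermSet : (Fin 5 → Fin 5 → Bool) → Set
IsPermSet P = (∀ r → ExactlyOne (λ c → P r c)) × (∀ c → ExactlyOne (λ r → P r c))

PermSet : Set
PermSet = Σ (Fin 5 → Fin 5 → Bool) IsPermSet

PermSetoid : Setoid 0ℓ 0ℓ
PermSetoid = record
  { Carrier = PermSet
  ; _≈_ = λ P Q → ∀ r c → proj₁ P r c ≡ proj₁ Q r c
  ; isEquivalence = record
    { refl = λ r c → refl
    ; sym = λ p r c → sym (p r c)
    ; trans = λ p q r c → trans (p r c) (q r c) } }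

IsS5Simplex : (Fin 5 → PermSet) → Set
IsS5Simplex τ = ∃[ P ] ((∀ r c → ExactlyOne (λ j → proj₁ (P j) r c))
                         × SameSet PermSetoid τ P)

-- Isomorphism of the (pure, 4-dimensional) simplicial complexes B²(Π) and
-- S₅: a bijection of vertex sets under which a family of five vertices
-- spans a 4-simplex of B²(Π) iff its image spans a 4-simplex of S₅.

B²Π≅S₅ : Set
B²Π≅S₅ = Σ (Inverse (BSetoid (B Π600)) PermSetoid) λ Φ →
           ∀ (σ : Fin 5 → BV (B Π600)) →
             IsBSimplex (B Π600) σ ⇔ IsS5Simplex (λ i → Inverse.to Φ (σ i))

-- Every five-colouring of the 600-cell Π is, after renaming colours, one of ten
-- colourings.  Their fifty colour classes are only twenty-five distinct sets, which
-- can be laid out on a 5 × 5 grid so that the ten colourings are exactly the rows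
-- and the columns; hence B(Π) is the rook graph K₅ □ K₅.  A five-colouring of the
-- rook graph is a Latin square and its colour classes are permutation sets;
-- conversely a partition of the grid into five permutation sets is a Latin square,
-- and every permutation set is the zero class of a cyclic Latin square.  The classification of the colourings of Π is a
-- certified search: once one tetrahedron is coloured 0, 1, 2, 3, all proper
-- extensions along a fixed vertex order are enumerated, and each complete one is
-- checked to be one of the ten.

module Submission where

open import Defs
open import Data.Bool using (Bool; true; false; T; _∧_; _∨_; if_then_else_)
import Data.Bool as Bool
open import Data.Bool.ListAction using (all; any)
open import Data.Bool.Properties using (T-∧; T-∨; T-≡)
open import Data.Empty using (⊥; ⊥-elim)
open import Data.Fin using (Fin; toℕ; _≟_; punchOut; #_)
import Data.Fin as Fin
open import Data.Fin.Patterns using (0F; 1F; 2F; 3F; 4F)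
open import Data.Fin.Properties using (all?; any?; pigeonhole; punchOut-injective; <⇒≢)
open import Data.Integer using (+_)
import Data.Integer as ℤ
open import Data.List using (List; []; _∷_; allFin)
import Data.List as List
import Data.List.Properties as List
open import Data.List.Membership.Propositional using (_∈_)
open import Data.List.Membership.DecPropositional (_≟_ {120}) using (_∈?_)
open import Data.List.Membership.Propositional.Properties using (∈-allFin)
open import Data.List.Relation.Unary.All using (All)
import Data.List.Relation.Unary.All as All
open import Data.List.Relation.Unary.All.Properties using (all⁺)
open import Data.List.Relation.Unary.Any using (Any; here; there; satisfied)
import Data.List.Relation.Unary.Any as Any
open import Data.List.Relation.Unary.Any.Properties using (any⁻)
open import Data.Maybe using (Maybe; just; nothing; maybe′; fromMaybe)
import Data.Maybe as Maybe
import Data.Maybe.Properties as Maybe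
open import Data.Nat using (ℕ; zero; suc; _+_; _∸_)
open import Data.Nat.DivMod using (_mod_)
open import Data.Nat.Properties using (n<1+n)
open import Data.Product using (Σ; ∃; ∃₂; _×_; _,_; proj₁; proj₂)
open import Data.Product.Properties using () renaming (≡-dec to ×-≡-dec)
open import Data.Sum using (_⊎_; inj₁; inj₂; [_,_])
open import Data.Unit using (tt)
open import Data.Vec using (Vec; []; _∷_)
import Data.Vec as Vec
open import Function using (_∘_; id)
open import Function.Bundles using (Inverse; Injection; Equivalence; _⇔_; mk⇔)
open import Function.Definitions using (Injective; Congruent)
open import Function.Properties.Inverse using (Inverse⇒Injection)
open import Relation.Binary using (Setoid)
open import Relation.Binary.PropositionalEquality hiding ([_])
open import Relation.Nullary using (¬_; Dec; does; yes; no; ¬?)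
open import Relation.Nullary.Decidable using (from-yes; _×-dec_; _→-dec_; dec-true; does-⇔)
open import Relation.Nullary.Negation using (contradiction)

dec-true⁻¹ : ∀ {A : Set} (a? : Dec A) → does a? ≡ true → A
dec-true⁻¹ (yes a) _ = a

injective⇒surjective : ∀ {n} {f : Fin n → Fin n} → Injective _≡_ _≡_ f →
                       ∀ k → ∃ λ i → f i ≡ k
injective⇒surjective {suc n} {f} f-inj k with any? (λ i → f i ≟ k)
... | yes hit  = hit
... | no  miss = collision (pigeonhole (n<1+n n) (λ i → punchOut (avoids i)))
  where
  avoids : ∀ i → k ≢ f i
  avoids i k≡fᵢ = miss (i , sym k≡fᵢ)
  collision : (∃₂ λ i j → i Fin.< j × punchOut (avoids i) ≡ punchOut (avoids j)) →
              ∃ λ i → f i ≡ k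
  collision (i , j , i<j , eq) =
    contradiction (f-inj (punchOut-injective (avoids i) (avoids j) eq)) (<⇒≢ i<j)

module _ {P : Fin 5 → Bool} where

  ExactlyOne-cong : ∀ {Q} → (∀ k → P k ≡ Q k) → ExactlyOne Q → ExactlyOne P
  ExactlyOne-cong P≗Q (k , Qk , unique) =
    k , trans (P≗Q k) Qk , λ k′ Pk′ → unique k′ (trans (sym (P≗Q k′)) Pk′)

  ExactlyOne-unique : ExactlyOne P → ∀ {i j} → P i ≡ true → P j ≡ true → i ≡ j
  ExactlyOne-unique (_ , _ , unique) Pi Pj = trans (unique _ Pi) (sym (unique _ Pj))

  ExactlyOne-indicator : (one : ExactlyOne P) → ∀ k → P k ≡ does (proj₁ one ≟ k)
  ExactlyOne-indicator (w , Pw , unique) k with w ≟ k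
  ... | yes refl = Pw
  ... | no  w≢k with P k in Pk
  ...   | true  = contradiction (sym (unique k Pk)) w≢k
  ...   | false = refl

ExactlyOne-≟ : ∀ c → ExactlyOne (λ k → does (c ≟ k))
ExactlyOne-≟ c = c , dec-true (c ≟ c) refl , λ k c≡k → sym (dec-true⁻¹ (c ≟ k) c≡k)

ExactlyOne-preimage : ∀ {f : Fin 5 → Fin 5} → Injective _≡_ _≡_ f →
                      ∀ k → ExactlyOne (λ i → does (f i ≟ k))
ExactlyOne-preimage {f} f-inj k with injective⇒surjective f-inj k
... | i , fᵢ≡k = i , dec-true (f i ≟ k) fᵢ≡k ,
                 λ j fⱼ≡k → f-inj (trans (dec-true⁻¹ (f j ≟ k) fⱼ≡k) (sym fᵢ≡k))

relabelled-classes : ∀ {A : Set} {f g : A → Fin 5} {ρ τ : Fin 5 → Fin 5} →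
                     Injective _≡_ _≡_ ρ → Injective _≡_ _≡_ τ →
                     (∀ x → ρ (f x) ≡ τ (g x)) →
                     ∀ c → ∃ λ k → ∀ x → does (f x ≟ c) ≡ does (g x ≟ k)
relabelled-classes {f = f} {g} {ρ} {τ} ρ-inj τ-inj ρf≗τg c
  with injective⇒surjective τ-inj (ρ c)
... | k , τk≡ρc = k , λ x → does-⇔ (mk⇔ (to x) (from x)) (f x ≟ c) (g x ≟ k)
  where
  to : ∀ x → f x ≡ c → g x ≡ k
  to x refl = τ-inj (trans (sym (ρf≗τg x)) (sym τk≡ρc))
  from : ∀ x → g x ≡ k → f x ≡ c
  from x refl = ρ-inj (trans (ρf≗τg x) τk≡ρc)

_‼_ : ∀ {A : Set} → List A → ℕ → Maybe A
[]       ‼ _     = nothing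
(x ∷ _)  ‼ zero  = just x
(_ ∷ xs) ‼ suc i = xs ‼ i

map-‼ : ∀ {A B : Set} (f : A → B) xs i → List.map f xs ‼ i ≡ Maybe.map f (xs ‼ i)
map-‼ f []       _       = refl
map-‼ f (x ∷ xs) zero    = refl
map-‼ f (x ∷ xs) (suc i) = map-‼ f xs i

map-≡-∈ : ∀ {A B : Set} {f g : A → B} {xs x} →
          List.map f xs ≡ List.map g xs → x ∈ xs → f x ≡ g x
map-≡-∈ {xs = _ ∷ _} eq (here refl) = List.∷-injectiveˡ eq
map-≡-∈ {xs = _ ∷ _} eq (there x∈) = map-≡-∈ (List.∷-injectiveʳ eq) x∈

SameLine : Grid → Grid → Set
SameLine (r , c) (r′ , c′) = r ≡ r′ ⊎ c ≡ c′

Rook : Grid → Grid → Set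
Rook p q = p ≢ q × SameLine p q

rook-row : ∀ {r c c′} → c ≢ c′ → Rook (r , c) (r , c′)
rook-row c≢c′ = c≢c′ ∘ cong proj₂ , inj₁ refl

rook-col : ∀ {r r′ c} → r ≢ r′ → Rook (r , c) (r′ , c)
rook-col r≢r′ = r≢r′ ∘ cong proj₁ , inj₂ refl

IsLatin : (Grid → Fin 5) → Set
IsLatin L = ∀ {p q} → Rook p q → L p ≢ L q

IsPermSet-cong : ∀ {P Q : Fin 5 → Fin 5 → Bool} → (∀ r c → P r c ≡ Q r c) →
                 IsPermSet Q → IsPermSet P
IsPermSet-cong P≗Q (rows , cols) = (λ r → ExactlyOne-cong (P≗Q r) (rows r))
                                  , (λ c → ExactlyOne-cong (λ r → P≗Q r c) (cols c))

module _ {L : Grid → Fin 5} (latin : IsLatin L) where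

  Latin-rowInjective : ∀ r → Injective _≡_ _≡_ (λ c → L (r , c))
  Latin-rowInjective r {c} {c′} eq with c ≟ c′
  ... | yes c≡c′ = c≡c′
  ... | no  c≢c′ = contradiction eq (latin (rook-row c≢c′))

  Latin-colInjective : ∀ c → Injective _≡_ _≡_ (λ r → L (r , c))
  Latin-colInjective c {r} {r′} eq with r ≟ r′
  ... | yes r≡r′ = r≡r′
  ... | no  r≢r′ = contradiction eq (latin (rook-col r≢r′))

  Latin-symbolClass : ∀ k → IsPermSet (λ r c → does (L (r , c) ≟ k))
  Latin-symbolClass k = (λ r → ExactlyOne-preimage (Latin-rowInjective r) k)
                      , (λ c → ExactlyOne-preimage (Latin-colInjective c) k)

module Partition (P : Fin 5 → PermSet)
                 (partition : ∀ r c → ExactlyOne (λ j → proj₁ (P j) r c)) where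

  symbol : Grid → Fin 5
  symbol (r , c) = proj₁ (partition r c)

  symbol-class : ∀ j r c → proj₁ (P j) r c ≡ does (symbol (r , c) ≟ j)
  symbol-class j r c = ExactlyOne-indicator (partition r c) j

  private
    inOwnClass : ∀ r c → proj₁ (P (symbol (r , c))) r c ≡ true
    inOwnClass r c = proj₁ (proj₂ (partition r c))

    inClass : ∀ {j} r c → symbol (r , c) ≡ j → proj₁ (P j) r c ≡ true
    inClass r c refl = inOwnClass r c

  symbol-isLatin : IsLatin symbol
  symbol-isLatin {r , c} {_ , c′} (p≢q , inj₁ refl) eq =
    p≢q (cong (r ,_) (ExactlyOne-unique (proj₁ (proj₂ (P (symbol (r , c)))) r)
                                        (inOwnClass r c) (inClass r c′ (sym eq))))
  symbol-isLatin {r , c} {r′ , _} (p≢q , inj₂ refl) eq =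
    p≢q (cong (_, c) (ExactlyOne-unique (proj₂ (proj₂ (P (symbol (r , c)))) c)
                                        (inOwnClass r c) (inClass r′ c (sym eq))))

cyclic : Fin 5 → Fin 5 → Fin 5
cyclic c d = (5 + toℕ c ∸ toℕ d) mod 5

cyclic-injectiveˡ : ∀ d c c′ → cyclic c d ≡ cyclic c′ d → c ≡ c′
cyclic-injectiveˡ = from-yes (all? λ d → all? λ c → all? λ c′ →
                      cyclic c d ≟ cyclic c′ d →-dec c ≟ c′)

cyclic-injectiveʳ : ∀ c d d′ → cyclic c d ≡ cyclic c d′ → d ≡ d′
cyclic-injectiveʳ = from-yes (all? λ c → all? λ d → all? λ d′ →
                      cyclic c d ≟ cyclic c d′ →-dec d ≟ d′)

cyclic-zero : ∀ c d → does (cyclic c d ≟ 0F) ≡ does (d ≟ c)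
cyclic-zero = from-yes (all? λ c → all? λ d → does (cyclic c d ≟ 0F) Bool.≟ does (d ≟ c))

module PermutationSquare (P : PermSet) where

  column : Fin 5 → Fin 5
  column r = proj₁ (proj₁ (proj₂ P) r)

  column-injective : Injective _≡_ _≡_ column
  column-injective {r} {r′} eq =
    ExactlyOne-unique (proj₂ (proj₂ P) (column r)) (inRow r)
                      (subst (λ c → proj₁ P r′ c ≡ true) (sym eq) (inRow r′))
    where
    inRow : ∀ r → proj₁ P r (column r) ≡ true
    inRow r = proj₁ (proj₂ (proj₁ (proj₂ P) r))

  square : Grid → Fin 5
  square (r , c) = cyclic c (column r)

  square-isLatin : IsLatin square
  square-isLatin {r , c} {_ , c′} (p≢q , inj₁ refl) eq =
    p≢q (cong (r ,_) (cyclic-injectiveˡ (column r) c c′ eq))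
  square-isLatin {r , c} {r′ , _} (p≢q , inj₂ refl) eq =
    p≢q (cong (_, c) (column-injective (cyclic-injectiveʳ c (column r) (column r′) eq)))

  square-zero : ∀ r c → does (square (r , c) ≟ 0F) ≡ proj₁ P r c
  square-zero r c =
    trans (cyclic-zero c (column r)) (sym (ExactlyOne-indicator (proj₁ (proj₂ P) r) c))

-- B of the rook graph K₅ □ K₅

module _ (H : Graph) where
  open Graph H

  record RookGraph : Set where
    field
      position          : V → Grid
      vertexAt          : Grid → V
      position-cong     : ∀ {x y} → x ≈ y → position x ≡ position y
      vertexAt-position : ∀ x → x ≈ vertexAt (position x)
      position-vertexAt : ∀ p → position (vertexAt p) ≡ p
      adj⇒rook          : ∀ {x y} → adj x y → Rook (position x) (position y)
      rook⇒adj          : ∀ {p q} → Rook p q → adj (vertexAt p) (vertexAt q)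

SameSet-transport : ∀ S T {σ τ σ′ τ′} →
                    (∀ {i j} → Setoid._≈_ S (σ i) (τ j) → Setoid._≈_ T (σ′ i) (τ′ j)) →
                    SameSet S σ τ → SameSet T σ′ τ′
SameSet-transport _ _ along (σ⊆τ , τ⊆σ) =
  (λ i → proj₁ (σ⊆τ i) , along (proj₂ (σ⊆τ i))) , (λ j → proj₁ (τ⊆σ j) , along (proj₂ (τ⊆σ j)))

module LatinSquares {H : Graph} (R : RookGraph H) where
  open Graph H
  open RookGraph R

  colouring : (L : Grid → Fin 5) → IsLatin L → FiveColouring H
  colouring L latin = L ∘ position , cong L ∘ position-cong , λ _ _ → latin ∘ adj⇒rook

  gridColours : FiveColouring H → Grid → Fin 5
  gridColours (f , _) = f ∘ vertexAt

  gridColours-isLatin : ∀ g → IsLatin (gridColours g)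
  gridColours-isLatin (_ , _ , proper) = proper _ _ ∘ rook⇒adj

  vertex-cong : (S : BV H) → ∀ {x y} → x ≈ y → proj₁ S x ≡ proj₁ S y
  vertex-cong (s , (f , f-cong , _) , k , s≗) {x} {y} x≈y = begin
    s x            ≡⟨ s≗ x ⟩
    does (f x ≟ k) ≡⟨ cong (λ c → does (c ≟ k)) (f-cong x≈y) ⟩
    does (f y ≟ k) ≡⟨ sym (s≗ y) ⟩
    s y            ∎
    where open ≡-Reasoning

  toPermSet : BV H → PermSet
  toPermSet (s , g , k , s≗) =
    (λ r c → s (vertexAt (r , c))) ,
    IsPermSet-cong (λ r c → s≗ (vertexAt (r , c))) (Latin-symbolClass (gridColours-isLatin g) k)

  fromPermSet : PermSet → BV H
  fromPermSet P = class H g 0F , g , 0F , λ _ → refl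
    where
    open PermutationSquare P
    g = colouring square square-isLatin

  fromPermSet-at : ∀ P x →
                   proj₁ (fromPermSet P) x ≡ proj₁ P (proj₁ (position x)) (proj₂ (position x))
  fromPermSet-at P x = square-zero (proj₁ (position x)) (proj₂ (position x))
    where open PermutationSquare P

  toPermSet-fromPermSet : ∀ P r c → proj₁ (toPermSet (fromPermSet P)) r c ≡ proj₁ P r c
  toPermSet-fromPermSet P r c =
    trans (fromPermSet-at P (vertexAt (r , c)))
          (cong (λ p → proj₁ P (proj₁ p) (proj₂ p)) (position-vertexAt (r , c)))

  fromPermSet-toPermSet : ∀ S x → proj₁ (fromPermSet (toPermSet S)) x ≡ proj₁ S x
  fromPermSet-toPermSet S x =
    trans (fromPermSet-at (toPermSet S) x) (vertex-cong S (Setoid.sym vertices (vertexAt-position x)))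

  bijection : Inverse (BSetoid H) PermSetoid
  bijection = record
    { to        = toPermSet
    ; from      = fromPermSet
    ; to-cong   = λ {S} {T} → to-cong {S} {T}
    ; from-cong = λ {P} {Q} → from-cong {P} {Q}
    ; inverse   = (λ {P} {S} S≈P′ r c →
                     trans (S≈P′ (vertexAt (r , c))) (toPermSet-fromPermSet P r c))
                , (λ {S} {P} P≈S′ x →
                     trans (from-cong {P} {toPermSet S} P≈S′ x) (fromPermSet-toPermSet S x))
    }
    where
    to-cong : Congruent (Setoid._≈_ (BSetoid H)) (Setoid._≈_ PermSetoid) toPermSet
    to-cong S≗T r c = S≗T (vertexAt (r , c))
    from-cong : Congruent (Setoid._≈_ PermSetoid) (Setoid._≈_ (BSetoid H)) fromPermSet
    from-cong {P} {Q} P≗Q x = begin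
      proj₁ (fromPermSet P) x ≡⟨ fromPermSet-at P x ⟩
      proj₁ P _ _             ≡⟨ P≗Q _ _ ⟩
      proj₁ Q _ _             ≡⟨ sym (fromPermSet-at Q x) ⟩
      proj₁ (fromPermSet Q) x ∎
      where open ≡-Reasoning

  classVertex : FiveColouring H → Fin 5 → BV H
  classVertex g k = class H g k , g , k , λ _ → refl

  simplex⇒partition : ∀ σ → IsBSimplex H σ → IsS5Simplex (toPermSet ∘ σ)
  simplex⇒partition σ (g , same) =
    toPermSet ∘ classVertex g ,
    (λ r c → ExactlyOne-≟ (gridColours g (r , c))) ,
    SameSet-transport (BSetoid H) PermSetoid
      {σ} {classVertex g} {toPermSet ∘ σ} {toPermSet ∘ classVertex g}
      (λ S≗T r c → S≗T (vertexAt (r , c))) same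

  partition⇒simplex : ∀ σ → IsS5Simplex (toPermSet ∘ σ) → IsBSimplex H σ
  partition⇒simplex σ (P , partition , same) =
    g , SameSet-transport PermSetoid (BSetoid H) {toPermSet ∘ σ} {P} {σ} {classVertex g} reflect same
    where
    open Partition P partition
    g = colouring symbol symbol-isLatin
    P≈class : ∀ j r c → proj₁ (P j) r c ≡ proj₁ (toPermSet (classVertex g j)) r c
    P≈class j r c =
      trans (symbol-class j r c) (cong (λ p → does (symbol p ≟ j)) (sym (position-vertexAt (r , c))))
    reflect : ∀ {i j} → (∀ r c → proj₁ (toPermSet (σ i)) r c ≡ proj₁ (P j) r c) →
              proj₁ (σ i) ≗ class H g j
    reflect {i} {j} σᵢ≈Pⱼ =
      Injection.injective (Inverse⇒Injection bijection) {σ i} {classVertex g j}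
        (λ r c → trans (σᵢ≈Pⱼ r c) (P≈class j r c))

  B≅S₅ : Σ (Inverse (BSetoid H) PermSetoid) λ Φ →
           ∀ σ → IsBSimplex H σ ⇔ IsS5Simplex (λ i → Inverse.to Φ (σ i))
  B≅S₅ = bijection , λ σ → mk⇔ (simplex⇒partition σ) (partition⇒simplex σ)

-- The 600-cell

Adj : PiV → PiV → Set
Adj = Graph.adj Π600

adj? : ∀ u v → Dec (Adj u v)
adj? u v =
  ×-≡-dec ℤ._≟_ ℤ._≟_ (dot (List.lookup icosians u) (List.lookup icosians v)) (+ 0 , + 2)

Proper : (PiV → Fin 5) → Set
Proper h = ∀ u v → Adj u v → h u ≢ h v

neighbourTable : Vec (List (Fin 120)) 120
neighbourTable =
    (# 24 ∷ # 25 ∷ # 26 ∷ # 36 ∷ # 37 ∷ # 38 ∷ # 48 ∷ # 49 ∷ # 50 ∷ # 60 ∷ # 61 ∷ # 62 ∷ [])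
  ∷ (# 27 ∷ # 30 ∷ # 33 ∷ # 39 ∷ # 42 ∷ # 45 ∷ # 51 ∷ # 54 ∷ # 57 ∷ # 63 ∷ # 66 ∷ # 69 ∷ [])
  ∷ (# 28 ∷ # 32 ∷ # 34 ∷ # 40 ∷ # 44 ∷ # 46 ∷ # 52 ∷ # 56 ∷ # 58 ∷ # 64 ∷ # 68 ∷ # 70 ∷ [])
  ∷ (# 29 ∷ # 31 ∷ # 35 ∷ # 41 ∷ # 43 ∷ # 47 ∷ # 53 ∷ # 55 ∷ # 59 ∷ # 65 ∷ # 67 ∷ # 71 ∷ [])
  ∷ (# 72 ∷ # 73 ∷ # 74 ∷ # 84 ∷ # 85 ∷ # 86 ∷ # 96 ∷ # 97 ∷ # 98 ∷ # 108 ∷ # 109 ∷ # 110 ∷ [])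
  ∷ (# 75 ∷ # 78 ∷ # 81 ∷ # 87 ∷ # 90 ∷ # 93 ∷ # 99 ∷ # 102 ∷ # 105 ∷ # 111 ∷ # 114 ∷ # 117 ∷ [])
  ∷ (# 76 ∷ # 80 ∷ # 82 ∷ # 88 ∷ # 92 ∷ # 94 ∷ # 100 ∷ # 104 ∷ # 106 ∷ # 112 ∷ # 116 ∷ # 118 ∷ [])
  ∷ (# 77 ∷ # 79 ∷ # 83 ∷ # 89 ∷ # 91 ∷ # 95 ∷ # 101 ∷ # 103 ∷ # 107 ∷ # 113 ∷ # 115 ∷ # 119 ∷ [])
  ∷ (# 24 ∷ # 25 ∷ # 26 ∷ # 27 ∷ # 28 ∷ # 29 ∷ # 30 ∷ # 31 ∷ # 32 ∷ # 33 ∷ # 34 ∷ # 35 ∷ [])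
  ∷ (# 24 ∷ # 28 ∷ # 30 ∷ # 38 ∷ # 39 ∷ # 46 ∷ # 49 ∷ # 56 ∷ # 57 ∷ # 77 ∷ # 79 ∷ # 83 ∷ [])
  ∷ (# 25 ∷ # 27 ∷ # 31 ∷ # 36 ∷ # 41 ∷ # 45 ∷ # 50 ∷ # 54 ∷ # 59 ∷ # 76 ∷ # 80 ∷ # 82 ∷ [])
  ∷ (# 36 ∷ # 39 ∷ # 49 ∷ # 54 ∷ # 62 ∷ # 69 ∷ # 76 ∷ # 79 ∷ # 89 ∷ # 94 ∷ # 104 ∷ # 107 ∷ [])
  ∷ (# 26 ∷ # 29 ∷ # 32 ∷ # 37 ∷ # 40 ∷ # 47 ∷ # 48 ∷ # 55 ∷ # 58 ∷ # 75 ∷ # 78 ∷ # 81 ∷ [])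
  ∷ (# 38 ∷ # 40 ∷ # 48 ∷ # 56 ∷ # 61 ∷ # 70 ∷ # 77 ∷ # 78 ∷ # 87 ∷ # 95 ∷ # 103 ∷ # 105 ∷ [])
  ∷ (# 37 ∷ # 41 ∷ # 50 ∷ # 55 ∷ # 60 ∷ # 71 ∷ # 75 ∷ # 80 ∷ # 88 ∷ # 93 ∷ # 102 ∷ # 106 ∷ [])
  ∷ (# 60 ∷ # 61 ∷ # 62 ∷ # 87 ∷ # 88 ∷ # 89 ∷ # 102 ∷ # 103 ∷ # 104 ∷ # 117 ∷ # 118 ∷ # 119 ∷ [])
  ∷ (# 33 ∷ # 34 ∷ # 35 ∷ # 42 ∷ # 43 ∷ # 44 ∷ # 51 ∷ # 52 ∷ # 53 ∷ # 72 ∷ # 73 ∷ # 74 ∷ [])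
  ∷ (# 42 ∷ # 46 ∷ # 52 ∷ # 57 ∷ # 63 ∷ # 68 ∷ # 72 ∷ # 83 ∷ # 86 ∷ # 91 ∷ # 97 ∷ # 101 ∷ [])
  ∷ (# 43 ∷ # 45 ∷ # 51 ∷ # 59 ∷ # 65 ∷ # 66 ∷ # 73 ∷ # 82 ∷ # 84 ∷ # 92 ∷ # 98 ∷ # 100 ∷ [])
  ∷ (# 63 ∷ # 66 ∷ # 69 ∷ # 84 ∷ # 91 ∷ # 94 ∷ # 97 ∷ # 100 ∷ # 107 ∷ # 110 ∷ # 113 ∷ # 116 ∷ [])
  ∷ (# 44 ∷ # 47 ∷ # 53 ∷ # 58 ∷ # 64 ∷ # 67 ∷ # 74 ∷ # 81 ∷ # 85 ∷ # 90 ∷ # 96 ∷ # 99 ∷ [])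
  ∷ (# 64 ∷ # 68 ∷ # 70 ∷ # 86 ∷ # 90 ∷ # 95 ∷ # 96 ∷ # 101 ∷ # 105 ∷ # 109 ∷ # 111 ∷ # 115 ∷ [])
  ∷ (# 65 ∷ # 67 ∷ # 71 ∷ # 85 ∷ # 92 ∷ # 93 ∷ # 98 ∷ # 99 ∷ # 106 ∷ # 108 ∷ # 112 ∷ # 114 ∷ [])
  ∷ (# 108 ∷ # 109 ∷ # 110 ∷ # 111 ∷ # 112 ∷ # 113 ∷ # 114 ∷ # 115 ∷ # 116 ∷ # 117 ∷ # 118 ∷ # 119 ∷ [])
  ∷ (# 0 ∷ # 8 ∷ # 9 ∷ # 25 ∷ # 26 ∷ # 27 ∷ # 28 ∷ # 30 ∷ # 36 ∷ # 38 ∷ # 39 ∷ # 49 ∷ [])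
  ∷ (# 0 ∷ # 8 ∷ # 10 ∷ # 24 ∷ # 26 ∷ # 27 ∷ # 29 ∷ # 31 ∷ # 36 ∷ # 37 ∷ # 41 ∷ # 50 ∷ [])
  ∷ (# 0 ∷ # 8 ∷ # 12 ∷ # 24 ∷ # 25 ∷ # 28 ∷ # 29 ∷ # 32 ∷ # 37 ∷ # 38 ∷ # 40 ∷ # 48 ∷ [])
  ∷ (# 1 ∷ # 8 ∷ # 10 ∷ # 24 ∷ # 25 ∷ # 30 ∷ # 31 ∷ # 33 ∷ # 36 ∷ # 39 ∷ # 45 ∷ # 54 ∷ [])
  ∷ (# 2 ∷ # 8 ∷ # 9 ∷ # 24 ∷ # 26 ∷ # 30 ∷ # 32 ∷ # 34 ∷ # 38 ∷ # 40 ∷ # 46 ∷ # 56 ∷ [])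
  ∷ (# 3 ∷ # 8 ∷ # 12 ∷ # 25 ∷ # 26 ∷ # 31 ∷ # 32 ∷ # 35 ∷ # 37 ∷ # 41 ∷ # 47 ∷ # 55 ∷ [])
  ∷ (# 1 ∷ # 8 ∷ # 9 ∷ # 24 ∷ # 27 ∷ # 28 ∷ # 33 ∷ # 34 ∷ # 39 ∷ # 42 ∷ # 46 ∷ # 57 ∷ [])
  ∷ (# 3 ∷ # 8 ∷ # 10 ∷ # 25 ∷ # 27 ∷ # 29 ∷ # 33 ∷ # 35 ∷ # 41 ∷ # 43 ∷ # 45 ∷ # 59 ∷ [])
  ∷ (# 2 ∷ # 8 ∷ # 12 ∷ # 26 ∷ # 28 ∷ # 29 ∷ # 34 ∷ # 35 ∷ # 40 ∷ # 44 ∷ # 47 ∷ # 58 ∷ [])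
  ∷ (# 1 ∷ # 8 ∷ # 16 ∷ # 27 ∷ # 30 ∷ # 31 ∷ # 34 ∷ # 35 ∷ # 42 ∷ # 43 ∷ # 45 ∷ # 51 ∷ [])
  ∷ (# 2 ∷ # 8 ∷ # 16 ∷ # 28 ∷ # 30 ∷ # 32 ∷ # 33 ∷ # 35 ∷ # 42 ∷ # 44 ∷ # 46 ∷ # 52 ∷ [])
  ∷ (# 3 ∷ # 8 ∷ # 16 ∷ # 29 ∷ # 31 ∷ # 32 ∷ # 33 ∷ # 34 ∷ # 43 ∷ # 44 ∷ # 47 ∷ # 53 ∷ [])
  ∷ (# 0 ∷ # 10 ∷ # 11 ∷ # 24 ∷ # 25 ∷ # 27 ∷ # 39 ∷ # 49 ∷ # 50 ∷ # 54 ∷ # 62 ∷ # 76 ∷ [])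
  ∷ (# 0 ∷ # 12 ∷ # 14 ∷ # 25 ∷ # 26 ∷ # 29 ∷ # 41 ∷ # 48 ∷ # 50 ∷ # 55 ∷ # 60 ∷ # 75 ∷ [])
  ∷ (# 0 ∷ # 9 ∷ # 13 ∷ # 24 ∷ # 26 ∷ # 28 ∷ # 40 ∷ # 48 ∷ # 49 ∷ # 56 ∷ # 61 ∷ # 77 ∷ [])
  ∷ (# 1 ∷ # 9 ∷ # 11 ∷ # 24 ∷ # 27 ∷ # 30 ∷ # 36 ∷ # 49 ∷ # 54 ∷ # 57 ∷ # 69 ∷ # 79 ∷ [])
  ∷ (# 2 ∷ # 12 ∷ # 13 ∷ # 26 ∷ # 28 ∷ # 32 ∷ # 38 ∷ # 48 ∷ # 56 ∷ # 58 ∷ # 70 ∷ # 78 ∷ [])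
  ∷ (# 3 ∷ # 10 ∷ # 14 ∷ # 25 ∷ # 29 ∷ # 31 ∷ # 37 ∷ # 50 ∷ # 55 ∷ # 59 ∷ # 71 ∷ # 80 ∷ [])
  ∷ (# 1 ∷ # 16 ∷ # 17 ∷ # 30 ∷ # 33 ∷ # 34 ∷ # 46 ∷ # 51 ∷ # 52 ∷ # 57 ∷ # 63 ∷ # 72 ∷ [])
  ∷ (# 3 ∷ # 16 ∷ # 18 ∷ # 31 ∷ # 33 ∷ # 35 ∷ # 45 ∷ # 51 ∷ # 53 ∷ # 59 ∷ # 65 ∷ # 73 ∷ [])
  ∷ (# 2 ∷ # 16 ∷ # 20 ∷ # 32 ∷ # 34 ∷ # 35 ∷ # 47 ∷ # 52 ∷ # 53 ∷ # 58 ∷ # 64 ∷ # 74 ∷ [])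
  ∷ (# 1 ∷ # 10 ∷ # 18 ∷ # 27 ∷ # 31 ∷ # 33 ∷ # 43 ∷ # 51 ∷ # 54 ∷ # 59 ∷ # 66 ∷ # 82 ∷ [])
  ∷ (# 2 ∷ # 9 ∷ # 17 ∷ # 28 ∷ # 30 ∷ # 34 ∷ # 42 ∷ # 52 ∷ # 56 ∷ # 57 ∷ # 68 ∷ # 83 ∷ [])
  ∷ (# 3 ∷ # 12 ∷ # 20 ∷ # 29 ∷ # 32 ∷ # 35 ∷ # 44 ∷ # 53 ∷ # 55 ∷ # 58 ∷ # 67 ∷ # 81 ∷ [])
  ∷ (# 0 ∷ # 12 ∷ # 13 ∷ # 26 ∷ # 37 ∷ # 38 ∷ # 40 ∷ # 60 ∷ # 61 ∷ # 75 ∷ # 78 ∷ # 87 ∷ [])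
  ∷ (# 0 ∷ # 9 ∷ # 11 ∷ # 24 ∷ # 36 ∷ # 38 ∷ # 39 ∷ # 61 ∷ # 62 ∷ # 77 ∷ # 79 ∷ # 89 ∷ [])
  ∷ (# 0 ∷ # 10 ∷ # 14 ∷ # 25 ∷ # 36 ∷ # 37 ∷ # 41 ∷ # 60 ∷ # 62 ∷ # 76 ∷ # 80 ∷ # 88 ∷ [])
  ∷ (# 1 ∷ # 16 ∷ # 18 ∷ # 33 ∷ # 42 ∷ # 43 ∷ # 45 ∷ # 63 ∷ # 66 ∷ # 72 ∷ # 73 ∷ # 84 ∷ [])
  ∷ (# 2 ∷ # 16 ∷ # 17 ∷ # 34 ∷ # 42 ∷ # 44 ∷ # 46 ∷ # 64 ∷ # 68 ∷ # 72 ∷ # 74 ∷ # 86 ∷ [])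
  ∷ (# 3 ∷ # 16 ∷ # 20 ∷ # 35 ∷ # 43 ∷ # 44 ∷ # 47 ∷ # 65 ∷ # 67 ∷ # 73 ∷ # 74 ∷ # 85 ∷ [])
  ∷ (# 1 ∷ # 10 ∷ # 11 ∷ # 27 ∷ # 36 ∷ # 39 ∷ # 45 ∷ # 66 ∷ # 69 ∷ # 76 ∷ # 82 ∷ # 94 ∷ [])
  ∷ (# 3 ∷ # 12 ∷ # 14 ∷ # 29 ∷ # 37 ∷ # 41 ∷ # 47 ∷ # 67 ∷ # 71 ∷ # 75 ∷ # 81 ∷ # 93 ∷ [])
  ∷ (# 2 ∷ # 9 ∷ # 13 ∷ # 28 ∷ # 38 ∷ # 40 ∷ # 46 ∷ # 68 ∷ # 70 ∷ # 77 ∷ # 83 ∷ # 95 ∷ [])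
  ∷ (# 1 ∷ # 9 ∷ # 17 ∷ # 30 ∷ # 39 ∷ # 42 ∷ # 46 ∷ # 63 ∷ # 69 ∷ # 79 ∷ # 83 ∷ # 91 ∷ [])
  ∷ (# 2 ∷ # 12 ∷ # 20 ∷ # 32 ∷ # 40 ∷ # 44 ∷ # 47 ∷ # 64 ∷ # 70 ∷ # 78 ∷ # 81 ∷ # 90 ∷ [])
  ∷ (# 3 ∷ # 10 ∷ # 18 ∷ # 31 ∷ # 41 ∷ # 43 ∷ # 45 ∷ # 65 ∷ # 71 ∷ # 80 ∷ # 82 ∷ # 92 ∷ [])
  ∷ (# 0 ∷ # 14 ∷ # 15 ∷ # 37 ∷ # 48 ∷ # 50 ∷ # 61 ∷ # 62 ∷ # 75 ∷ # 87 ∷ # 88 ∷ # 102 ∷ [])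
  ∷ (# 0 ∷ # 13 ∷ # 15 ∷ # 38 ∷ # 48 ∷ # 49 ∷ # 60 ∷ # 62 ∷ # 77 ∷ # 87 ∷ # 89 ∷ # 103 ∷ [])
  ∷ (# 0 ∷ # 11 ∷ # 15 ∷ # 36 ∷ # 49 ∷ # 50 ∷ # 60 ∷ # 61 ∷ # 76 ∷ # 88 ∷ # 89 ∷ # 104 ∷ [])
  ∷ (# 1 ∷ # 17 ∷ # 19 ∷ # 42 ∷ # 51 ∷ # 57 ∷ # 66 ∷ # 69 ∷ # 72 ∷ # 84 ∷ # 91 ∷ # 97 ∷ [])
  ∷ (# 2 ∷ # 20 ∷ # 21 ∷ # 44 ∷ # 52 ∷ # 58 ∷ # 68 ∷ # 70 ∷ # 74 ∷ # 86 ∷ # 90 ∷ # 96 ∷ [])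
  ∷ (# 3 ∷ # 18 ∷ # 22 ∷ # 43 ∷ # 53 ∷ # 59 ∷ # 67 ∷ # 71 ∷ # 73 ∷ # 85 ∷ # 92 ∷ # 98 ∷ [])
  ∷ (# 1 ∷ # 18 ∷ # 19 ∷ # 45 ∷ # 51 ∷ # 54 ∷ # 63 ∷ # 69 ∷ # 82 ∷ # 84 ∷ # 94 ∷ # 100 ∷ [])
  ∷ (# 3 ∷ # 20 ∷ # 22 ∷ # 47 ∷ # 53 ∷ # 55 ∷ # 65 ∷ # 71 ∷ # 81 ∷ # 85 ∷ # 93 ∷ # 99 ∷ [])
  ∷ (# 2 ∷ # 17 ∷ # 21 ∷ # 46 ∷ # 52 ∷ # 56 ∷ # 64 ∷ # 70 ∷ # 83 ∷ # 86 ∷ # 95 ∷ # 101 ∷ [])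
  ∷ (# 1 ∷ # 11 ∷ # 19 ∷ # 39 ∷ # 54 ∷ # 57 ∷ # 63 ∷ # 66 ∷ # 79 ∷ # 91 ∷ # 94 ∷ # 107 ∷ [])
  ∷ (# 2 ∷ # 13 ∷ # 21 ∷ # 40 ∷ # 56 ∷ # 58 ∷ # 64 ∷ # 68 ∷ # 78 ∷ # 90 ∷ # 95 ∷ # 105 ∷ [])
  ∷ (# 3 ∷ # 14 ∷ # 22 ∷ # 41 ∷ # 55 ∷ # 59 ∷ # 65 ∷ # 67 ∷ # 80 ∷ # 92 ∷ # 93 ∷ # 106 ∷ [])
  ∷ (# 4 ∷ # 16 ∷ # 17 ∷ # 42 ∷ # 51 ∷ # 52 ∷ # 63 ∷ # 73 ∷ # 74 ∷ # 84 ∷ # 86 ∷ # 97 ∷ [])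
  ∷ (# 4 ∷ # 16 ∷ # 18 ∷ # 43 ∷ # 51 ∷ # 53 ∷ # 65 ∷ # 72 ∷ # 74 ∷ # 84 ∷ # 85 ∷ # 98 ∷ [])
  ∷ (# 4 ∷ # 16 ∷ # 20 ∷ # 44 ∷ # 52 ∷ # 53 ∷ # 64 ∷ # 72 ∷ # 73 ∷ # 85 ∷ # 86 ∷ # 96 ∷ [])
  ∷ (# 5 ∷ # 12 ∷ # 14 ∷ # 37 ∷ # 48 ∷ # 55 ∷ # 60 ∷ # 78 ∷ # 81 ∷ # 87 ∷ # 93 ∷ # 102 ∷ [])
  ∷ (# 6 ∷ # 10 ∷ # 11 ∷ # 36 ∷ # 50 ∷ # 54 ∷ # 62 ∷ # 80 ∷ # 82 ∷ # 88 ∷ # 94 ∷ # 104 ∷ [])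
  ∷ (# 7 ∷ # 9 ∷ # 13 ∷ # 38 ∷ # 49 ∷ # 56 ∷ # 61 ∷ # 79 ∷ # 83 ∷ # 89 ∷ # 95 ∷ # 103 ∷ [])
  ∷ (# 5 ∷ # 12 ∷ # 13 ∷ # 40 ∷ # 48 ∷ # 58 ∷ # 70 ∷ # 75 ∷ # 81 ∷ # 87 ∷ # 90 ∷ # 105 ∷ [])
  ∷ (# 7 ∷ # 9 ∷ # 11 ∷ # 39 ∷ # 49 ∷ # 57 ∷ # 69 ∷ # 77 ∷ # 83 ∷ # 89 ∷ # 91 ∷ # 107 ∷ [])
  ∷ (# 6 ∷ # 10 ∷ # 14 ∷ # 41 ∷ # 50 ∷ # 59 ∷ # 71 ∷ # 76 ∷ # 82 ∷ # 88 ∷ # 92 ∷ # 106 ∷ [])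
  ∷ (# 5 ∷ # 12 ∷ # 20 ∷ # 47 ∷ # 55 ∷ # 58 ∷ # 67 ∷ # 75 ∷ # 78 ∷ # 90 ∷ # 93 ∷ # 99 ∷ [])
  ∷ (# 6 ∷ # 10 ∷ # 18 ∷ # 45 ∷ # 54 ∷ # 59 ∷ # 66 ∷ # 76 ∷ # 80 ∷ # 92 ∷ # 94 ∷ # 100 ∷ [])
  ∷ (# 7 ∷ # 9 ∷ # 17 ∷ # 46 ∷ # 56 ∷ # 57 ∷ # 68 ∷ # 77 ∷ # 79 ∷ # 91 ∷ # 95 ∷ # 101 ∷ [])
  ∷ (# 4 ∷ # 18 ∷ # 19 ∷ # 51 ∷ # 63 ∷ # 66 ∷ # 72 ∷ # 73 ∷ # 97 ∷ # 98 ∷ # 100 ∷ # 110 ∷ [])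
  ∷ (# 4 ∷ # 20 ∷ # 22 ∷ # 53 ∷ # 65 ∷ # 67 ∷ # 73 ∷ # 74 ∷ # 96 ∷ # 98 ∷ # 99 ∷ # 108 ∷ [])
  ∷ (# 4 ∷ # 17 ∷ # 21 ∷ # 52 ∷ # 64 ∷ # 68 ∷ # 72 ∷ # 74 ∷ # 96 ∷ # 97 ∷ # 101 ∷ # 109 ∷ [])
  ∷ (# 5 ∷ # 13 ∷ # 15 ∷ # 48 ∷ # 60 ∷ # 61 ∷ # 75 ∷ # 78 ∷ # 102 ∷ # 103 ∷ # 105 ∷ # 117 ∷ [])
  ∷ (# 6 ∷ # 14 ∷ # 15 ∷ # 50 ∷ # 60 ∷ # 62 ∷ # 76 ∷ # 80 ∷ # 102 ∷ # 104 ∷ # 106 ∷ # 118 ∷ [])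
  ∷ (# 7 ∷ # 11 ∷ # 15 ∷ # 49 ∷ # 61 ∷ # 62 ∷ # 77 ∷ # 79 ∷ # 103 ∷ # 104 ∷ # 107 ∷ # 119 ∷ [])
  ∷ (# 5 ∷ # 20 ∷ # 21 ∷ # 58 ∷ # 64 ∷ # 70 ∷ # 78 ∷ # 81 ∷ # 96 ∷ # 99 ∷ # 105 ∷ # 111 ∷ [])
  ∷ (# 7 ∷ # 17 ∷ # 19 ∷ # 57 ∷ # 63 ∷ # 69 ∷ # 79 ∷ # 83 ∷ # 97 ∷ # 101 ∷ # 107 ∷ # 113 ∷ [])
  ∷ (# 6 ∷ # 18 ∷ # 22 ∷ # 59 ∷ # 65 ∷ # 71 ∷ # 80 ∷ # 82 ∷ # 98 ∷ # 100 ∷ # 106 ∷ # 112 ∷ [])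
  ∷ (# 5 ∷ # 14 ∷ # 22 ∷ # 55 ∷ # 67 ∷ # 71 ∷ # 75 ∷ # 81 ∷ # 99 ∷ # 102 ∷ # 106 ∷ # 114 ∷ [])
  ∷ (# 6 ∷ # 11 ∷ # 19 ∷ # 54 ∷ # 66 ∷ # 69 ∷ # 76 ∷ # 82 ∷ # 100 ∷ # 104 ∷ # 107 ∷ # 116 ∷ [])
  ∷ (# 7 ∷ # 13 ∷ # 21 ∷ # 56 ∷ # 68 ∷ # 70 ∷ # 77 ∷ # 83 ∷ # 101 ∷ # 103 ∷ # 105 ∷ # 115 ∷ [])
  ∷ (# 4 ∷ # 20 ∷ # 21 ∷ # 64 ∷ # 74 ∷ # 85 ∷ # 86 ∷ # 90 ∷ # 99 ∷ # 108 ∷ # 109 ∷ # 111 ∷ [])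
  ∷ (# 4 ∷ # 17 ∷ # 19 ∷ # 63 ∷ # 72 ∷ # 84 ∷ # 86 ∷ # 91 ∷ # 101 ∷ # 109 ∷ # 110 ∷ # 113 ∷ [])
  ∷ (# 4 ∷ # 18 ∷ # 22 ∷ # 65 ∷ # 73 ∷ # 84 ∷ # 85 ∷ # 92 ∷ # 100 ∷ # 108 ∷ # 110 ∷ # 112 ∷ [])
  ∷ (# 5 ∷ # 20 ∷ # 22 ∷ # 67 ∷ # 81 ∷ # 85 ∷ # 90 ∷ # 93 ∷ # 96 ∷ # 108 ∷ # 111 ∷ # 114 ∷ [])
  ∷ (# 6 ∷ # 18 ∷ # 19 ∷ # 66 ∷ # 82 ∷ # 84 ∷ # 92 ∷ # 94 ∷ # 98 ∷ # 110 ∷ # 112 ∷ # 116 ∷ [])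
  ∷ (# 7 ∷ # 17 ∷ # 21 ∷ # 68 ∷ # 83 ∷ # 86 ∷ # 91 ∷ # 95 ∷ # 97 ∷ # 109 ∷ # 113 ∷ # 115 ∷ [])
  ∷ (# 5 ∷ # 14 ∷ # 15 ∷ # 60 ∷ # 75 ∷ # 87 ∷ # 88 ∷ # 93 ∷ # 106 ∷ # 114 ∷ # 117 ∷ # 118 ∷ [])
  ∷ (# 7 ∷ # 13 ∷ # 15 ∷ # 61 ∷ # 77 ∷ # 87 ∷ # 89 ∷ # 95 ∷ # 105 ∷ # 115 ∷ # 117 ∷ # 119 ∷ [])
  ∷ (# 6 ∷ # 11 ∷ # 15 ∷ # 62 ∷ # 76 ∷ # 88 ∷ # 89 ∷ # 94 ∷ # 107 ∷ # 116 ∷ # 118 ∷ # 119 ∷ [])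
  ∷ (# 5 ∷ # 13 ∷ # 21 ∷ # 70 ∷ # 78 ∷ # 87 ∷ # 90 ∷ # 95 ∷ # 103 ∷ # 111 ∷ # 115 ∷ # 117 ∷ [])
  ∷ (# 6 ∷ # 14 ∷ # 22 ∷ # 71 ∷ # 80 ∷ # 88 ∷ # 92 ∷ # 93 ∷ # 102 ∷ # 112 ∷ # 114 ∷ # 118 ∷ [])
  ∷ (# 7 ∷ # 11 ∷ # 19 ∷ # 69 ∷ # 79 ∷ # 89 ∷ # 91 ∷ # 94 ∷ # 104 ∷ # 113 ∷ # 116 ∷ # 119 ∷ [])
  ∷ (# 4 ∷ # 22 ∷ # 23 ∷ # 85 ∷ # 96 ∷ # 98 ∷ # 99 ∷ # 109 ∷ # 110 ∷ # 111 ∷ # 112 ∷ # 114 ∷ [])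
  ∷ (# 4 ∷ # 21 ∷ # 23 ∷ # 86 ∷ # 96 ∷ # 97 ∷ # 101 ∷ # 108 ∷ # 110 ∷ # 111 ∷ # 113 ∷ # 115 ∷ [])
  ∷ (# 4 ∷ # 19 ∷ # 23 ∷ # 84 ∷ # 97 ∷ # 98 ∷ # 100 ∷ # 108 ∷ # 109 ∷ # 112 ∷ # 113 ∷ # 116 ∷ [])
  ∷ (# 5 ∷ # 21 ∷ # 23 ∷ # 90 ∷ # 96 ∷ # 99 ∷ # 105 ∷ # 108 ∷ # 109 ∷ # 114 ∷ # 115 ∷ # 117 ∷ [])
  ∷ (# 6 ∷ # 22 ∷ # 23 ∷ # 92 ∷ # 98 ∷ # 100 ∷ # 106 ∷ # 108 ∷ # 110 ∷ # 114 ∷ # 116 ∷ # 118 ∷ [])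
  ∷ (# 7 ∷ # 19 ∷ # 23 ∷ # 91 ∷ # 97 ∷ # 101 ∷ # 107 ∷ # 109 ∷ # 110 ∷ # 115 ∷ # 116 ∷ # 119 ∷ [])
  ∷ (# 5 ∷ # 22 ∷ # 23 ∷ # 93 ∷ # 99 ∷ # 102 ∷ # 106 ∷ # 108 ∷ # 111 ∷ # 112 ∷ # 117 ∷ # 118 ∷ [])
  ∷ (# 7 ∷ # 21 ∷ # 23 ∷ # 95 ∷ # 101 ∷ # 103 ∷ # 105 ∷ # 109 ∷ # 111 ∷ # 113 ∷ # 117 ∷ # 119 ∷ [])
  ∷ (# 6 ∷ # 19 ∷ # 23 ∷ # 94 ∷ # 100 ∷ # 104 ∷ # 107 ∷ # 110 ∷ # 112 ∷ # 113 ∷ # 118 ∷ # 119 ∷ [])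
  ∷ (# 5 ∷ # 15 ∷ # 23 ∷ # 87 ∷ # 102 ∷ # 103 ∷ # 105 ∷ # 111 ∷ # 114 ∷ # 115 ∷ # 118 ∷ # 119 ∷ [])
  ∷ (# 6 ∷ # 15 ∷ # 23 ∷ # 88 ∷ # 102 ∷ # 104 ∷ # 106 ∷ # 112 ∷ # 114 ∷ # 116 ∷ # 117 ∷ # 119 ∷ [])
  ∷ (# 7 ∷ # 15 ∷ # 23 ∷ # 89 ∷ # 103 ∷ # 104 ∷ # 107 ∷ # 113 ∷ # 115 ∷ # 116 ∷ # 117 ∷ # 118 ∷ [])
  ∷ []

neighbours : PiV → List PiV
neighbours = Vec.lookup neighbourTable

neighbours-complete : ∀ u v → Adj u v → v ∈ neighbours u
neighbours-complete = from-yes (all? λ u → all? λ v → adj? u v →-dec v ∈? neighbours u)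

-- The ten canonical colourings, indexed by the lines of the grid

data Line : Set where
  row col : Fin 5 → Line

onLine : Line → Fin 5 → Grid
onLine (row r) k = r , k
onLine (col c) k = k , c

onLine-sameLine : ∀ ℓ k k′ → SameLine (onLine ℓ k) (onLine ℓ k′)
onLine-sameLine (row r) k k′ = inj₁ refl
onLine-sameLine (col c) k k′ = inj₂ refl

-- Entry r, v of the first table is the column of the cell of row r whose colour class
-- contains v; entry c, v of the second is the row of the cell of column c containing v.
rowColouringTable : Vec (Vec (Fin 5) 120) 5
rowColouringTable =
    (1F ∷ 1F ∷ 1F ∷ 1F ∷ 1F ∷ 1F ∷ 1F ∷ 1F ∷ 1F ∷ 1F ∷ 1F ∷ 1F ∷ 1F ∷ 1F ∷ 1F ∷ 1F ∷ 1F ∷ 1F ∷ 1F ∷ 1F ∷ 1F ∷ 1F ∷ 1F ∷ 1F ∷ 2F ∷ 3F ∷ 4F ∷ 4F ∷ 3F ∷ 2F ∷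
     0F ∷ 0F ∷ 0F ∷ 2F ∷ 4F ∷ 3F ∷ 0F ∷ 0F ∷ 0F ∷ 3F ∷ 2F ∷ 4F ∷ 3F ∷ 4F ∷ 2F ∷ 3F ∷ 2F ∷ 4F ∷ 3F ∷ 4F ∷ 2F ∷ 0F ∷ 0F ∷ 0F ∷ 2F ∷ 3F ∷ 4F ∷ 4F ∷ 3F ∷ 2F ∷
     4F ∷ 2F ∷ 3F ∷ 2F ∷ 4F ∷ 3F ∷ 4F ∷ 2F ∷ 3F ∷ 0F ∷ 0F ∷ 0F ∷ 4F ∷ 2F ∷ 3F ∷ 2F ∷ 4F ∷ 3F ∷ 4F ∷ 2F ∷ 3F ∷ 0F ∷ 0F ∷ 0F ∷ 3F ∷ 4F ∷ 2F ∷ 0F ∷ 0F ∷ 0F ∷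
     2F ∷ 3F ∷ 4F ∷ 4F ∷ 3F ∷ 2F ∷ 0F ∷ 0F ∷ 0F ∷ 3F ∷ 2F ∷ 4F ∷ 3F ∷ 4F ∷ 2F ∷ 3F ∷ 2F ∷ 4F ∷ 2F ∷ 3F ∷ 4F ∷ 4F ∷ 3F ∷ 2F ∷ 0F ∷ 0F ∷ 0F ∷ 2F ∷ 4F ∷ 3F ∷ [])
  ∷ (0F ∷ 2F ∷ 4F ∷ 3F ∷ 0F ∷ 2F ∷ 4F ∷ 3F ∷ 0F ∷ 2F ∷ 3F ∷ 3F ∷ 4F ∷ 2F ∷ 4F ∷ 0F ∷ 0F ∷ 4F ∷ 2F ∷ 4F ∷ 3F ∷ 3F ∷ 2F ∷ 0F ∷ 3F ∷ 4F ∷ 2F ∷ 1F ∷ 1F ∷ 1F ∷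
     4F ∷ 2F ∷ 3F ∷ 3F ∷ 2F ∷ 4F ∷ 2F ∷ 3F ∷ 4F ∷ 0F ∷ 0F ∷ 0F ∷ 1F ∷ 1F ∷ 1F ∷ 0F ∷ 0F ∷ 0F ∷ 1F ∷ 1F ∷ 1F ∷ 4F ∷ 3F ∷ 2F ∷ 4F ∷ 2F ∷ 3F ∷ 3F ∷ 2F ∷ 4F ∷
     2F ∷ 3F ∷ 4F ∷ 0F ∷ 0F ∷ 0F ∷ 3F ∷ 4F ∷ 2F ∷ 1F ∷ 1F ∷ 1F ∷ 2F ∷ 3F ∷ 4F ∷ 0F ∷ 0F ∷ 0F ∷ 3F ∷ 4F ∷ 2F ∷ 1F ∷ 1F ∷ 1F ∷ 1F ∷ 1F ∷ 1F ∷ 4F ∷ 3F ∷ 2F ∷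
     4F ∷ 2F ∷ 3F ∷ 3F ∷ 2F ∷ 4F ∷ 2F ∷ 3F ∷ 4F ∷ 0F ∷ 0F ∷ 0F ∷ 1F ∷ 1F ∷ 1F ∷ 0F ∷ 0F ∷ 0F ∷ 3F ∷ 4F ∷ 2F ∷ 1F ∷ 1F ∷ 1F ∷ 4F ∷ 2F ∷ 3F ∷ 3F ∷ 2F ∷ 4F ∷ [])
  ∷ (3F ∷ 4F ∷ 2F ∷ 0F ∷ 3F ∷ 4F ∷ 2F ∷ 0F ∷ 2F ∷ 3F ∷ 2F ∷ 4F ∷ 0F ∷ 0F ∷ 3F ∷ 4F ∷ 4F ∷ 3F ∷ 0F ∷ 0F ∷ 4F ∷ 2F ∷ 3F ∷ 2F ∷ 4F ∷ 0F ∷ 1F ∷ 3F ∷ 0F ∷ 3F ∷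
     1F ∷ 4F ∷ 4F ∷ 0F ∷ 3F ∷ 1F ∷ 1F ∷ 2F ∷ 2F ∷ 2F ∷ 3F ∷ 1F ∷ 2F ∷ 2F ∷ 0F ∷ 1F ∷ 4F ∷ 2F ∷ 4F ∷ 0F ∷ 4F ∷ 3F ∷ 1F ∷ 3F ∷ 0F ∷ 4F ∷ 1F ∷ 0F ∷ 1F ∷ 3F ∷
     0F ∷ 1F ∷ 2F ∷ 1F ∷ 3F ∷ 4F ∷ 2F ∷ 1F ∷ 0F ∷ 3F ∷ 4F ∷ 2F ∷ 0F ∷ 1F ∷ 2F ∷ 1F ∷ 3F ∷ 4F ∷ 2F ∷ 1F ∷ 0F ∷ 3F ∷ 4F ∷ 2F ∷ 4F ∷ 0F ∷ 4F ∷ 3F ∷ 1F ∷ 3F ∷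
     0F ∷ 4F ∷ 1F ∷ 0F ∷ 1F ∷ 3F ∷ 1F ∷ 2F ∷ 2F ∷ 2F ∷ 3F ∷ 1F ∷ 2F ∷ 2F ∷ 0F ∷ 1F ∷ 4F ∷ 2F ∷ 4F ∷ 0F ∷ 1F ∷ 3F ∷ 0F ∷ 3F ∷ 1F ∷ 4F ∷ 4F ∷ 0F ∷ 3F ∷ 1F ∷ [])
  ∷ (2F ∷ 0F ∷ 3F ∷ 4F ∷ 2F ∷ 0F ∷ 3F ∷ 4F ∷ 4F ∷ 4F ∷ 0F ∷ 2F ∷ 2F ∷ 3F ∷ 0F ∷ 3F ∷ 3F ∷ 0F ∷ 3F ∷ 2F ∷ 2F ∷ 0F ∷ 4F ∷ 4F ∷ 0F ∷ 1F ∷ 3F ∷ 2F ∷ 2F ∷ 0F ∷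
     3F ∷ 3F ∷ 1F ∷ 1F ∷ 0F ∷ 2F ∷ 4F ∷ 4F ∷ 1F ∷ 1F ∷ 4F ∷ 2F ∷ 4F ∷ 0F ∷ 4F ∷ 4F ∷ 1F ∷ 3F ∷ 0F ∷ 3F ∷ 3F ∷ 2F ∷ 2F ∷ 1F ∷ 3F ∷ 1F ∷ 0F ∷ 2F ∷ 0F ∷ 1F ∷
     1F ∷ 4F ∷ 0F ∷ 3F ∷ 1F ∷ 2F ∷ 1F ∷ 0F ∷ 4F ∷ 4F ∷ 2F ∷ 3F ∷ 1F ∷ 4F ∷ 0F ∷ 3F ∷ 1F ∷ 2F ∷ 1F ∷ 0F ∷ 4F ∷ 4F ∷ 2F ∷ 3F ∷ 0F ∷ 3F ∷ 3F ∷ 2F ∷ 2F ∷ 1F ∷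
     3F ∷ 1F ∷ 0F ∷ 2F ∷ 0F ∷ 1F ∷ 4F ∷ 4F ∷ 1F ∷ 1F ∷ 4F ∷ 2F ∷ 4F ∷ 0F ∷ 4F ∷ 4F ∷ 1F ∷ 3F ∷ 0F ∷ 1F ∷ 3F ∷ 2F ∷ 2F ∷ 0F ∷ 3F ∷ 3F ∷ 1F ∷ 1F ∷ 0F ∷ 2F ∷ [])
  ∷ (4F ∷ 3F ∷ 0F ∷ 2F ∷ 4F ∷ 3F ∷ 0F ∷ 2F ∷ 3F ∷ 0F ∷ 4F ∷ 0F ∷ 3F ∷ 4F ∷ 2F ∷ 2F ∷ 2F ∷ 2F ∷ 4F ∷ 3F ∷ 0F ∷ 4F ∷ 0F ∷ 3F ∷ 1F ∷ 2F ∷ 0F ∷ 0F ∷ 4F ∷ 4F ∷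
     2F ∷ 1F ∷ 2F ∷ 4F ∷ 1F ∷ 0F ∷ 3F ∷ 1F ∷ 3F ∷ 4F ∷ 1F ∷ 3F ∷ 0F ∷ 3F ∷ 3F ∷ 2F ∷ 3F ∷ 1F ∷ 2F ∷ 2F ∷ 0F ∷ 1F ∷ 4F ∷ 4F ∷ 1F ∷ 0F ∷ 2F ∷ 1F ∷ 4F ∷ 0F ∷
     3F ∷ 0F ∷ 1F ∷ 4F ∷ 2F ∷ 1F ∷ 0F ∷ 3F ∷ 1F ∷ 2F ∷ 3F ∷ 4F ∷ 3F ∷ 0F ∷ 1F ∷ 4F ∷ 2F ∷ 1F ∷ 0F ∷ 3F ∷ 1F ∷ 2F ∷ 3F ∷ 4F ∷ 2F ∷ 2F ∷ 0F ∷ 1F ∷ 4F ∷ 4F ∷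
     1F ∷ 0F ∷ 2F ∷ 1F ∷ 4F ∷ 0F ∷ 3F ∷ 1F ∷ 3F ∷ 4F ∷ 1F ∷ 3F ∷ 0F ∷ 3F ∷ 3F ∷ 2F ∷ 3F ∷ 1F ∷ 1F ∷ 2F ∷ 0F ∷ 0F ∷ 4F ∷ 4F ∷ 2F ∷ 1F ∷ 2F ∷ 4F ∷ 1F ∷ 0F ∷ [])
  ∷ []

columnColouringTable : Vec (Vec (Fin 5) 120) 5
columnColouringTable =
    (1F ∷ 3F ∷ 4F ∷ 2F ∷ 1F ∷ 3F ∷ 4F ∷ 2F ∷ 1F ∷ 4F ∷ 3F ∷ 4F ∷ 2F ∷ 2F ∷ 3F ∷ 1F ∷ 1F ∷ 3F ∷ 2F ∷ 2F ∷ 4F ∷ 3F ∷ 4F ∷ 1F ∷ 3F ∷ 2F ∷ 4F ∷ 4F ∷ 2F ∷ 3F ∷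
     0F ∷ 0F ∷ 0F ∷ 2F ∷ 3F ∷ 4F ∷ 0F ∷ 0F ∷ 0F ∷ 1F ∷ 1F ∷ 1F ∷ 4F ∷ 3F ∷ 2F ∷ 1F ∷ 1F ∷ 1F ∷ 3F ∷ 2F ∷ 4F ∷ 0F ∷ 0F ∷ 0F ∷ 2F ∷ 4F ∷ 3F ∷ 2F ∷ 3F ∷ 4F ∷
     2F ∷ 4F ∷ 3F ∷ 1F ∷ 1F ∷ 1F ∷ 4F ∷ 3F ∷ 2F ∷ 0F ∷ 0F ∷ 0F ∷ 2F ∷ 4F ∷ 3F ∷ 1F ∷ 1F ∷ 1F ∷ 4F ∷ 3F ∷ 2F ∷ 0F ∷ 0F ∷ 0F ∷ 3F ∷ 2F ∷ 4F ∷ 0F ∷ 0F ∷ 0F ∷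
     2F ∷ 4F ∷ 3F ∷ 2F ∷ 3F ∷ 4F ∷ 0F ∷ 0F ∷ 0F ∷ 1F ∷ 1F ∷ 1F ∷ 4F ∷ 3F ∷ 2F ∷ 1F ∷ 1F ∷ 1F ∷ 3F ∷ 2F ∷ 4F ∷ 4F ∷ 2F ∷ 3F ∷ 0F ∷ 0F ∷ 0F ∷ 2F ∷ 3F ∷ 4F ∷ [])
  ∷ (0F ∷ 0F ∷ 0F ∷ 0F ∷ 0F ∷ 0F ∷ 0F ∷ 0F ∷ 0F ∷ 0F ∷ 0F ∷ 0F ∷ 0F ∷ 0F ∷ 0F ∷ 0F ∷ 0F ∷ 0F ∷ 0F ∷ 0F ∷ 0F ∷ 0F ∷ 0F ∷ 0F ∷ 4F ∷ 3F ∷ 2F ∷ 1F ∷ 1F ∷ 1F ∷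
     2F ∷ 4F ∷ 3F ∷ 3F ∷ 4F ∷ 2F ∷ 2F ∷ 4F ∷ 3F ∷ 3F ∷ 4F ∷ 2F ∷ 1F ∷ 1F ∷ 1F ∷ 2F ∷ 3F ∷ 4F ∷ 1F ∷ 1F ∷ 1F ∷ 4F ∷ 2F ∷ 3F ∷ 4F ∷ 3F ∷ 2F ∷ 4F ∷ 2F ∷ 3F ∷
     3F ∷ 2F ∷ 4F ∷ 2F ∷ 3F ∷ 4F ∷ 3F ∷ 2F ∷ 4F ∷ 1F ∷ 1F ∷ 1F ∷ 3F ∷ 2F ∷ 4F ∷ 2F ∷ 3F ∷ 4F ∷ 3F ∷ 2F ∷ 4F ∷ 1F ∷ 1F ∷ 1F ∷ 1F ∷ 1F ∷ 1F ∷ 4F ∷ 2F ∷ 3F ∷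
     4F ∷ 3F ∷ 2F ∷ 4F ∷ 2F ∷ 3F ∷ 2F ∷ 4F ∷ 3F ∷ 3F ∷ 4F ∷ 2F ∷ 1F ∷ 1F ∷ 1F ∷ 2F ∷ 3F ∷ 4F ∷ 4F ∷ 3F ∷ 2F ∷ 1F ∷ 1F ∷ 1F ∷ 2F ∷ 4F ∷ 3F ∷ 3F ∷ 4F ∷ 2F ∷ [])
  ∷ (3F ∷ 1F ∷ 2F ∷ 4F ∷ 3F ∷ 1F ∷ 2F ∷ 4F ∷ 2F ∷ 1F ∷ 2F ∷ 3F ∷ 3F ∷ 1F ∷ 4F ∷ 4F ∷ 4F ∷ 4F ∷ 1F ∷ 3F ∷ 3F ∷ 2F ∷ 1F ∷ 2F ∷ 0F ∷ 4F ∷ 1F ∷ 3F ∷ 3F ∷ 0F ∷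
     4F ∷ 1F ∷ 4F ∷ 0F ∷ 1F ∷ 3F ∷ 1F ∷ 2F ∷ 2F ∷ 2F ∷ 0F ∷ 3F ∷ 2F ∷ 2F ∷ 0F ∷ 4F ∷ 0F ∷ 2F ∷ 4F ∷ 4F ∷ 0F ∷ 3F ∷ 3F ∷ 1F ∷ 0F ∷ 1F ∷ 4F ∷ 3F ∷ 1F ∷ 0F ∷
     1F ∷ 0F ∷ 2F ∷ 0F ∷ 4F ∷ 3F ∷ 2F ∷ 0F ∷ 1F ∷ 4F ∷ 3F ∷ 2F ∷ 1F ∷ 0F ∷ 2F ∷ 0F ∷ 4F ∷ 3F ∷ 2F ∷ 0F ∷ 1F ∷ 4F ∷ 3F ∷ 2F ∷ 4F ∷ 4F ∷ 0F ∷ 3F ∷ 3F ∷ 1F ∷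
     0F ∷ 1F ∷ 4F ∷ 3F ∷ 1F ∷ 0F ∷ 1F ∷ 2F ∷ 2F ∷ 2F ∷ 0F ∷ 3F ∷ 2F ∷ 2F ∷ 0F ∷ 4F ∷ 0F ∷ 2F ∷ 0F ∷ 4F ∷ 1F ∷ 3F ∷ 3F ∷ 0F ∷ 4F ∷ 1F ∷ 4F ∷ 0F ∷ 1F ∷ 3F ∷ [])
  ∷ (2F ∷ 4F ∷ 3F ∷ 1F ∷ 2F ∷ 4F ∷ 3F ∷ 1F ∷ 4F ∷ 2F ∷ 1F ∷ 1F ∷ 4F ∷ 3F ∷ 2F ∷ 3F ∷ 3F ∷ 2F ∷ 3F ∷ 4F ∷ 1F ∷ 1F ∷ 2F ∷ 4F ∷ 1F ∷ 0F ∷ 3F ∷ 2F ∷ 0F ∷ 2F ∷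
     3F ∷ 3F ∷ 1F ∷ 1F ∷ 2F ∷ 0F ∷ 4F ∷ 1F ∷ 4F ∷ 0F ∷ 2F ∷ 4F ∷ 0F ∷ 4F ∷ 4F ∷ 0F ∷ 4F ∷ 3F ∷ 0F ∷ 3F ∷ 3F ∷ 2F ∷ 1F ∷ 2F ∷ 3F ∷ 0F ∷ 1F ∷ 1F ∷ 0F ∷ 2F ∷
     4F ∷ 1F ∷ 0F ∷ 3F ∷ 2F ∷ 0F ∷ 1F ∷ 4F ∷ 0F ∷ 2F ∷ 4F ∷ 3F ∷ 4F ∷ 1F ∷ 0F ∷ 3F ∷ 2F ∷ 0F ∷ 1F ∷ 4F ∷ 0F ∷ 2F ∷ 4F ∷ 3F ∷ 0F ∷ 3F ∷ 3F ∷ 2F ∷ 1F ∷ 2F ∷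
     3F ∷ 0F ∷ 1F ∷ 1F ∷ 0F ∷ 2F ∷ 4F ∷ 1F ∷ 4F ∷ 0F ∷ 2F ∷ 4F ∷ 0F ∷ 4F ∷ 4F ∷ 0F ∷ 4F ∷ 3F ∷ 1F ∷ 0F ∷ 3F ∷ 2F ∷ 0F ∷ 2F ∷ 3F ∷ 3F ∷ 1F ∷ 1F ∷ 2F ∷ 0F ∷ [])
  ∷ (4F ∷ 2F ∷ 1F ∷ 3F ∷ 4F ∷ 2F ∷ 1F ∷ 3F ∷ 3F ∷ 3F ∷ 4F ∷ 2F ∷ 1F ∷ 4F ∷ 1F ∷ 2F ∷ 2F ∷ 1F ∷ 4F ∷ 1F ∷ 2F ∷ 4F ∷ 3F ∷ 3F ∷ 2F ∷ 1F ∷ 0F ∷ 0F ∷ 4F ∷ 4F ∷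
     1F ∷ 2F ∷ 2F ∷ 4F ∷ 0F ∷ 1F ∷ 3F ∷ 3F ∷ 1F ∷ 4F ∷ 3F ∷ 0F ∷ 3F ∷ 0F ∷ 3F ∷ 3F ∷ 2F ∷ 0F ∷ 2F ∷ 0F ∷ 2F ∷ 1F ∷ 4F ∷ 4F ∷ 1F ∷ 2F ∷ 0F ∷ 0F ∷ 4F ∷ 1F ∷
     0F ∷ 3F ∷ 1F ∷ 4F ∷ 0F ∷ 2F ∷ 0F ∷ 1F ∷ 3F ∷ 3F ∷ 2F ∷ 4F ∷ 0F ∷ 3F ∷ 1F ∷ 4F ∷ 0F ∷ 2F ∷ 0F ∷ 1F ∷ 3F ∷ 3F ∷ 2F ∷ 4F ∷ 2F ∷ 0F ∷ 2F ∷ 1F ∷ 4F ∷ 4F ∷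
     1F ∷ 2F ∷ 0F ∷ 0F ∷ 4F ∷ 1F ∷ 3F ∷ 3F ∷ 1F ∷ 4F ∷ 3F ∷ 0F ∷ 3F ∷ 0F ∷ 3F ∷ 3F ∷ 2F ∷ 0F ∷ 2F ∷ 1F ∷ 0F ∷ 0F ∷ 4F ∷ 4F ∷ 1F ∷ 2F ∷ 2F ∷ 4F ∷ 0F ∷ 1F ∷ [])
  ∷ []

lineColour : Line → PiV → Fin 5
lineColour (row r) = Vec.lookup (Vec.lookup rowColouringTable r)
lineColour (col c) = Vec.lookup (Vec.lookup columnColouringTable c)

lineColour-proper : ∀ ℓ → Proper (lineColour ℓ)
lineColour-proper ℓ u v uv = All.lookup (avoids ℓ u) (neighbours-complete u v uv)
  where
  avoids : ∀ ℓ u → All (λ v → lineColour ℓ u ≢ lineColour ℓ v) (neighbours u)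
  avoids (row r) = from-yes (all? λ r → all? λ u → All.all? (λ v →
                     ¬? (lineColour (row r) u ≟ lineColour (row r) v)) (neighbours u)) r
  avoids (col c) = from-yes (all? λ c → all? λ u → All.all? (λ v →
                     ¬? (lineColour (col c) u ≟ lineColour (col c) v)) (neighbours u)) c

lineColouring : Line → FiveColouring Π600
lineColouring ℓ = lineColour ℓ , cong (lineColour ℓ) , lineColour-proper ℓ

rows-columns-consistent : ∀ r c v →
                          does (lineColour (col c) v ≟ r) ≡ does (lineColour (row r) v ≟ c)
rows-columns-consistent = from-yes (all? λ r → all? λ c → all? λ v →
                            does (lineColour (col c) v ≟ r) Bool.≟ does (lineColour (row r) v ≟ c))

grid : Grid → Subset Π600
grid (r , c) = class Π600 (lineColouring (row r)) c

class-onLine : ∀ ℓ k → class Π600 (lineColouring ℓ) k ≗ grid (onLine ℓ k)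
class-onLine (row r) k v = refl
class-onLine (col c) k v = rows-columns-consistent k c v

-- Normalising the colours of a tetrahedron

relabel : Fin 5 → Fin 5 → Fin 5 → Fin 5 → Fin 5 → Fin 5
relabel a b c d x =
  if does (x ≟ a) then 0F else if does (x ≟ b) then 1F else
  if does (x ≟ c) then 2F else if does (x ≟ d) then 3F else 4F

Distinct₄ : Fin 5 → Fin 5 → Fin 5 → Fin 5 → Set
Distinct₄ a b c d = a ≢ b × a ≢ c × a ≢ d × b ≢ c × b ≢ d × c ≢ d

distinct₄? : ∀ a b c d → Dec (Distinct₄ a b c d)
distinct₄? a b c d = ¬? (a ≟ b) ×-dec ¬? (a ≟ c) ×-dec ¬? (a ≟ d) ×-dec
                     ¬? (b ≟ c) ×-dec ¬? (b ≟ d) ×-dec ¬? (c ≟ d)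

relabel-injective : ∀ a b c d → Distinct₄ a b c d →
                    ∀ x y → relabel a b c d x ≡ relabel a b c d y → x ≡ y
relabel-injective = from-yes (all? λ a → all? λ b → all? λ c → all? λ d → distinct₄? a b c d →-dec
                      all? λ x → all? λ y → relabel a b c d x ≟ relabel a b c d y →-dec x ≟ y)

relabel-seed : ∀ a b c d → Distinct₄ a b c d →
               relabel a b c d d ∷ relabel a b c d c ∷ relabel a b c d b ∷ relabel a b c d a ∷ []
                 ≡ 3F ∷ 2F ∷ 1F ∷ 0F ∷ []
relabel-seed = from-yes (all? λ a → all? λ b → all? λ c → all? λ d → distinct₄? a b c d →-dec
                 List.≡-dec _≟_
                   (relabel a b c d d ∷ relabel a b c d c ∷ relabel a b c d b ∷ relabel a b c d a ∷ [])
                   (3F ∷ 2F ∷ 1F ∷ 0F ∷ []))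

t₀ t₁ t₂ t₃ : PiV
t₀ = # 0
t₁ = # 24
t₂ = # 25
t₃ = # 26

seed-distinct : ∀ {h} → Proper h → Distinct₄ (h t₀) (h t₁) (h t₂) (h t₃)
seed-distinct proper =
  proper t₀ t₁ (from-yes (adj? t₀ t₁)) , proper t₀ t₂ (from-yes (adj? t₀ t₂)) ,
  proper t₀ t₃ (from-yes (adj? t₀ t₃)) , proper t₁ t₂ (from-yes (adj? t₁ t₂)) ,
  proper t₁ t₃ (from-yes (adj? t₁ t₃)) , proper t₂ t₃ (from-yes (adj? t₂ t₃))

seedRelabel : (PiV → Fin 5) → Fin 5 → Fin 5
seedRelabel h = relabel (h t₀) (h t₁) (h t₂) (h t₃)

seedRelabel-injective : ∀ {h} → Proper h → Injective _≡_ _≡_ (seedRelabel h)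
seedRelabel-injective {h} proper = relabel-injective _ _ _ _ (seed-distinct {h} proper) _ _

normalise : (PiV → Fin 5) → PiV → Fin 5
normalise h = seedRelabel h ∘ h

normalise-proper : ∀ {h} → Proper h → Proper (normalise h)
normalise-proper {h} proper u v uv = proper u v uv ∘ seedRelabel-injective {h} proper

seedOrder : List PiV
seedOrder = t₃ ∷ t₂ ∷ t₁ ∷ t₀ ∷ []

normalise-seed : ∀ {h} → Proper h → List.map (normalise h) seedOrder ≡ 3F ∷ 2F ∷ 1F ∷ 0F ∷ []
normalise-seed {h} proper = relabel-seed _ _ _ _ (seed-distinct {h} proper)

-- A step (v , back) colours v next; back lists the positions of the earlier-coloured
-- neighbours of v, counted from the most recently coloured vertex.
Step : Set
Step = PiV × List ℕ

visit : List PiV → List Step → List PiV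
visit done []                = done
visit done ((v , _) ∷ steps) = visit (v ∷ done) steps

adjacentAt : PiV → Maybe PiV → Bool
adjacentAt v = maybe′ (λ u → does (adj? v u)) false

adjacentAt-just : ∀ v {m} → T (adjacentAt v m) → ∃ λ u → m ≡ just u × Adj v u
adjacentAt-just v {just u} adjacent =
  u , refl , dec-true⁻¹ (adj? v u) (Equivalence.to T-≡ adjacent)

backNeighbours : PiV → List PiV → List ℕ → Bool
backNeighbours v done = all (λ i → adjacentAt v (done ‼ i))

validSteps : List PiV → List Step → Bool
validSteps done []                   = true
validSteps done ((v , back) ∷ steps) = backNeighbours v done back ∧ validSteps (v ∷ done) steps

clashAt : Fin 5 → List (Fin 5) → ℕ → Bool
clashAt k colours i = does (Maybe.≡-dec _≟_ (colours ‼ i) (just k))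

clash : Fin 5 → List (Fin 5) → List ℕ → Bool
clash k colours = any (clashAt k colours)

explore   : (List (Fin 5) → Bool) → List Step → List (Fin 5) → Bool
tryColour : (List (Fin 5) → Bool) → List Step → List ℕ → List (Fin 5) → Fin 5 → Bool

explore leaf []                   colours = leaf colours
explore leaf ((_ , back) ∷ steps) colours = all (tryColour leaf steps back colours) (allFin 5)

tryColour leaf steps back colours k = clash k colours back ∨ explore leaf steps (k ∷ colours)

module _ {h : PiV → Fin 5} (proper : Proper h) where

  neighbour-colour : ∀ v done i → T (adjacentAt v (done ‼ i)) → List.map h done ‼ i ≢ just (h v)
  neighbour-colour v done i adjacentᵢ clashᵢ =
    contradict (adjacentAt-just v {done ‼ i} adjacentᵢ)
    where
    open ≡-Reasoning
    contradict : (∃ λ u → done ‼ i ≡ just u × Adj v u) → ⊥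
    contradict (u , at-i , vu) = proper v u vu (sym (Maybe.just-injective (begin
      just (h u)             ≡⟨ cong (Maybe.map h) at-i ⟨
      Maybe.map h (done ‼ i) ≡⟨ map-‼ h done i ⟨
      List.map h done ‼ i    ≡⟨ clashᵢ ⟩
      just (h v)             ∎)))

  no-clash : ∀ v done back → T (backNeighbours v done back) →
             ¬ T (clash (h v) (List.map h done) back)
  no-clash v done back adjacent clashes =
    neighbour-colour v done i (proj₁ atᵢ)
      (dec-true⁻¹ (Maybe.≡-dec _≟_ (List.map h done ‼ i) (just (h v)))
                  (Equivalence.to T-≡ (proj₂ atᵢ)))
    where
    clashing : Any (T ∘ clashAt (h v) (List.map h done)) back
    clashing = any⁻ (clashAt (h v) (List.map h done)) back clashes
    i : ℕ
    i = Any.lookup clashing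
    atᵢ : T (adjacentAt v (done ‼ i)) × T (clashAt (h v) (List.map h done) i)
    atᵢ = All.lookupAny (all⁺ (adjacentAt v ∘ (done ‼_)) back adjacent) clashing

  explore-sound : ∀ leaf done steps → T (validSteps done steps) →
                  T (explore leaf steps (List.map h done)) → T (leaf (List.map h (visit done steps)))
  explore-sound leaf done []                   _     found = found
  explore-sound leaf done ((v , back) ∷ steps) valid found =
    explore-sound leaf (v ∷ done) steps (proj₂ valid′) (resolve (All.lookup choices (∈-allFin (h v))))
    where
    valid′ : T (backNeighbours v done back) × T (validSteps (v ∷ done) steps)
    valid′ = Equivalence.to T-∧ valid
    choices : All (T ∘ tryColour leaf steps back (List.map h done)) (allFin 5)
    choices = all⁺ (tryColour leaf steps back (List.map h done)) (allFin 5) found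
    resolve : T (tryColour leaf steps back (List.map h done) (h v)) →
              T (explore leaf steps (List.map h (v ∷ done)))
    resolve = [ ⊥-elim ∘ no-clash v done back (proj₁ valid′) , id ] ∘ Equivalence.to T-∨

stepTable : List (Fin 120 × List ℕ)
stepTable =
    (# 8 , (2 ∷ 1 ∷ 0 ∷ [])) ∷ (# 27 , (0 ∷ 3 ∷ 2 ∷ [])) ∷ (# 36 , (5 ∷ 4 ∷ 3 ∷ 0 ∷ []))
  ∷ (# 10 , (4 ∷ 1 ∷ 0 ∷ [])) ∷ (# 31 , (3 ∷ 0 ∷ 5 ∷ 2 ∷ [])) ∷ (# 29 , (4 ∷ 6 ∷ 5 ∷ 0 ∷ []))
  ∷ (# 37 , (9 ∷ 7 ∷ 6 ∷ 0 ∷ [])) ∷ (# 41 , (3 ∷ 8 ∷ 1 ∷ 2 ∷ 0 ∷ [])) ∷ (# 50 , (11 ∷ 4 ∷ 9 ∷ 5 ∷ 1 ∷ 0 ∷ []))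
  ∷ (# 3 , (3 ∷ 4 ∷ 1 ∷ [])) ∷ (# 35 , (0 ∷ 9 ∷ 4 ∷ 5 ∷ [])) ∷ (# 32 , (10 ∷ 11 ∷ 5 ∷ 0 ∷ []))
  ∷ (# 12 , (12 ∷ 6 ∷ 0 ∷ 5 ∷ [])) ∷ (# 47 , (3 ∷ 0 ∷ 7 ∷ 1 ∷ 2 ∷ [])) ∷ (# 55 , (4 ∷ 1 ∷ 8 ∷ 7 ∷ 6 ∷ 0 ∷ []))
  ∷ (# 14 , (8 ∷ 7 ∷ 6 ∷ 0 ∷ [])) ∷ (# 28 , (15 ∷ 18 ∷ 16 ∷ 4 ∷ [])) ∷ (# 30 , (16 ∷ 19 ∷ 15 ∷ 0 ∷ []))
  ∷ (# 33 , (17 ∷ 16 ∷ 0 ∷ 13 ∷ 7 ∷ [])) ∷ (# 34 , (18 ∷ 2 ∷ 1 ∷ 7 ∷ 0 ∷ 8 ∷ [])) ∷ (# 38 , (23 ∷ 22 ∷ 20 ∷ 3 ∷ []))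
  ∷ (# 40 , (8 ∷ 21 ∷ 4 ∷ 9 ∷ 0 ∷ [])) ∷ (# 48 , (25 ∷ 9 ∷ 22 ∷ 15 ∷ 1 ∷ 0 ∷ [])) ∷ (# 60 , (26 ∷ 7 ∷ 16 ∷ 0 ∷ 14 ∷ []))
  ∷ (# 75 , (11 ∷ 8 ∷ 17 ∷ 1 ∷ 9 ∷ 0 ∷ [])) ∷ (# 2 , (8 ∷ 13 ∷ 5 ∷ 3 ∷ [])) ∷ (# 44 , (0 ∷ 14 ∷ 6 ∷ 15 ∷ 12 ∷ []))
  ∷ (# 58 , (1 ∷ 14 ∷ 15 ∷ 5 ∷ 0 ∷ 13 ∷ [])) ∷ (# 78 , (15 ∷ 6 ∷ 5 ∷ 0 ∷ 3 ∷ [])) ∷ (# 81 , (16 ∷ 15 ∷ 14 ∷ 1 ∷ 4 ∷ 0 ∷ []))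
  ∷ (# 9 , (32 ∷ 13 ∷ 12 ∷ 9 ∷ [])) ∷ (# 39 , (0 ∷ 33 ∷ 29 ∷ 13 ∷ 28 ∷ [])) ∷ (# 49 , (35 ∷ 1 ∷ 34 ∷ 29 ∷ 11 ∷ 0 ∷ []))
  ∷ (# 46 , (7 ∷ 2 ∷ 16 ∷ 15 ∷ 13 ∷ [])) ∷ (# 56 , (8 ∷ 3 ∷ 17 ∷ 13 ∷ 12 ∷ 0 ∷ [])) ∷ (# 13 , (14 ∷ 13 ∷ 12 ∷ 0 ∷ 6 ∷ []))
  ∷ (# 61 , (39 ∷ 0 ∷ 15 ∷ 13 ∷ 3 ∷ 12 ∷ [])) ∷ (# 62 , (40 ∷ 34 ∷ 4 ∷ 28 ∷ 13 ∷ 0 ∷ [])) ∷ (# 70 , (12 ∷ 2 ∷ 16 ∷ 3 ∷ 10 ∷ 9 ∷ []))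
  ∷ (# 77 , (8 ∷ 3 ∷ 18 ∷ 6 ∷ 4 ∷ 2 ∷ [])) ∷ (# 87 , (4 ∷ 17 ∷ 16 ∷ 3 ∷ 15 ∷ 11 ∷ [])) ∷ (# 1 , (39 ∷ 23 ∷ 22 ∷ 9 ∷ []))
  ∷ (# 42 , (0 ∷ 24 ∷ 23 ∷ 22 ∷ 8 ∷ [])) ∷ (# 57 , (1 ∷ 12 ∷ 25 ∷ 11 ∷ 0 ∷ 9 ∷ [])) ∷ (# 16 , (25 ∷ 24 ∷ 33 ∷ 1 ∷ 17 ∷ []))
  ∷ (# 52 , (19 ∷ 0 ∷ 25 ∷ 2 ∷ 18 ∷ 11 ∷ [])) ∷ (# 43 , (36 ∷ 1 ∷ 41 ∷ 27 ∷ 35 ∷ [])) ∷ (# 45 , (5 ∷ 43 ∷ 45 ∷ 42 ∷ 28 ∷ 0 ∷ []))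
  ∷ (# 51 , (6 ∷ 3 ∷ 29 ∷ 5 ∷ 1 ∷ 0 ∷ [])) ∷ (# 53 , (39 ∷ 4 ∷ 38 ∷ 2 ∷ 22 ∷ 35 ∷ [])) ∷ (# 54 , (8 ∷ 46 ∷ 48 ∷ 47 ∷ 18 ∷ 2 ∷ []))
  ∷ (# 59 , (41 ∷ 47 ∷ 46 ∷ 43 ∷ 4 ∷ 3 ∷ [])) ∷ (# 11 , (49 ∷ 20 ∷ 19 ∷ 1 ∷ 14 ∷ [])) ∷ (# 76 , (49 ∷ 0 ∷ 50 ∷ 44 ∷ 2 ∷ 15 ∷ []))
  ∷ (# 79 , (23 ∷ 1 ∷ 22 ∷ 21 ∷ 10 ∷ 14 ∷ [])) ∷ (# 69 , (13 ∷ 2 ∷ 23 ∷ 4 ∷ 11 ∷ 0 ∷ [])) ∷ (# 80 , (52 ∷ 40 ∷ 48 ∷ 47 ∷ 4 ∷ 2 ∷ []))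
  ∷ (# 71 , (47 ∷ 41 ∷ 49 ∷ 42 ∷ 5 ∷ 0 ∷ [])) ∷ (# 67 , (48 ∷ 44 ∷ 8 ∷ 43 ∷ 0 ∷ 28 ∷ [])) ∷ (# 20 , (32 ∷ 45 ∷ 9 ∷ 31 ∷ 0 ∷ 29 ∷ []))
  ∷ (# 64 , (34 ∷ 0 ∷ 33 ∷ 14 ∷ 32 ∷ 21 ∷ [])) ∷ (# 65 , (51 ∷ 14 ∷ 11 ∷ 9 ∷ 2 ∷ 3 ∷ [])) ∷ (# 68 , (36 ∷ 28 ∷ 16 ∷ 27 ∷ 1 ∷ 23 ∷ []))
  ∷ (# 83 , (32 ∷ 29 ∷ 28 ∷ 19 ∷ 0 ∷ 23 ∷ 8 ∷ [])) ∷ (# 17 , (21 ∷ 30 ∷ 18 ∷ 20 ∷ 1 ∷ 0 ∷ [])) ∷ (# 63 , (23 ∷ 0 ∷ 22 ∷ 16 ∷ 21 ∷ 9 ∷ []))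
  ∷ (# 66 , (24 ∷ 18 ∷ 17 ∷ 15 ∷ 0 ∷ 10 ∷ [])) ∷ (# 82 , (63 ∷ 19 ∷ 16 ∷ 15 ∷ 0 ∷ 13 ∷ 10 ∷ [])) ∷ (# 18 , (21 ∷ 20 ∷ 19 ∷ 16 ∷ 6 ∷ 1 ∷ 0 ∷ []))
  ∷ (# 72 , (24 ∷ 4 ∷ 26 ∷ 20 ∷ 23 ∷ 3 ∷ [])) ∷ (# 73 , (25 ∷ 1 ∷ 23 ∷ 21 ∷ 20 ∷ 8 ∷ 0 ∷ [])) ∷ (# 74 , (26 ∷ 11 ∷ 44 ∷ 25 ∷ 21 ∷ 10 ∷ 1 ∷ 0 ∷ []))
  ∷ (# 84 , (3 ∷ 23 ∷ 6 ∷ 5 ∷ 2 ∷ 1 ∷ [])) ∷ (# 85 , (13 ∷ 23 ∷ 11 ∷ 14 ∷ 2 ∷ 1 ∷ [])) ∷ (# 86 , (9 ∷ 28 ∷ 13 ∷ 11 ∷ 4 ∷ 2 ∷ []))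
  ∷ (# 4 , (5 ∷ 4 ∷ 3 ∷ 2 ∷ 1 ∷ 0 ∷ [])) ∷ (# 88 , (60 ∷ 67 ∷ 52 ∷ 38 ∷ 22 ∷ 19 ∷ [])) ∷ (# 89 , (24 ∷ 44 ∷ 40 ∷ 39 ∷ 37 ∷ 22 ∷ []))
  ∷ (# 15 , (54 ∷ 41 ∷ 40 ∷ 37 ∷ 1 ∷ 0 ∷ [])) ∷ (# 90 , (19 ∷ 51 ∷ 18 ∷ 40 ∷ 50 ∷ 49 ∷ [])) ∷ (# 96 , (4 ∷ 20 ∷ 19 ∷ 8 ∷ 6 ∷ 5 ∷ 0 ∷ []))
  ∷ (# 21 , (20 ∷ 18 ∷ 42 ∷ 6 ∷ 1 ∷ 0 ∷ [])) ∷ (# 95 , (46 ∷ 0 ∷ 47 ∷ 19 ∷ 43 ∷ 42 ∷ 18 ∷ [])) ∷ (# 103 , (47 ∷ 4 ∷ 46 ∷ 43 ∷ 42 ∷ 5 ∷ 0 ∷ []))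
  ∷ (# 105 , (48 ∷ 2 ∷ 45 ∷ 55 ∷ 43 ∷ 4 ∷ 1 ∷ 0 ∷ [])) ∷ (# 5 , (60 ∷ 56 ∷ 55 ∷ 44 ∷ 5 ∷ 0 ∷ [])) ∷ (# 93 , (0 ∷ 70 ∷ 71 ∷ 27 ∷ 28 ∷ 61 ∷ 56 ∷ []))
  ∷ (# 99 , (1 ∷ 27 ∷ 28 ∷ 57 ∷ 13 ∷ 7 ∷ 0 ∷ 6 ∷ [])) ∷ (# 102 , (2 ∷ 72 ∷ 9 ∷ 64 ∷ 63 ∷ 47 ∷ 11 ∷ 1 ∷ [])) ∷ (# 7 , (49 ∷ 34 ∷ 25 ∷ 11 ∷ 6 ∷ 5 ∷ []))
  ∷ (# 91 , (0 ∷ 25 ∷ 46 ∷ 24 ∷ 34 ∷ 35 ∷ 26 ∷ [])) ∷ (# 101 , (1 ∷ 26 ∷ 9 ∷ 28 ∷ 27 ∷ 16 ∷ 0 ∷ 8 ∷ [])) ∷ (# 97 , (16 ∷ 27 ∷ 26 ∷ 22 ∷ 19 ∷ 17 ∷ 1 ∷ 0 ∷ []))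
  ∷ (# 19 , (27 ∷ 26 ∷ 37 ∷ 20 ∷ 2 ∷ 0 ∷ [])) ∷ (# 94 , (41 ∷ 0 ∷ 43 ∷ 27 ∷ 38 ∷ 40 ∷ 26 ∷ [])) ∷ (# 107 , (5 ∷ 42 ∷ 1 ∷ 39 ∷ 40 ∷ 17 ∷ 4 ∷ 0 ∷ []))
  ∷ (# 104 , (43 ∷ 17 ∷ 58 ∷ 42 ∷ 19 ∷ 18 ∷ 1 ∷ 0 ∷ [])) ∷ (# 6 , (43 ∷ 40 ∷ 29 ∷ 20 ∷ 2 ∷ 0 ∷ [])) ∷ (# 92 , (0 ∷ 29 ∷ 46 ∷ 36 ∷ 40 ∷ 41 ∷ 30 ∷ []))
  ∷ (# 100 , (1 ∷ 30 ∷ 5 ∷ 32 ∷ 31 ∷ 26 ∷ 0 ∷ 4 ∷ [])) ∷ (# 98 , (24 ∷ 31 ∷ 38 ∷ 29 ∷ 27 ∷ 26 ∷ 1 ∷ 0 ∷ [])) ∷ (# 22 , (39 ∷ 42 ∷ 43 ∷ 27 ∷ 2 ∷ 14 ∷ 0 ∷ 13 ∷ []))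
  ∷ (# 106 , (4 ∷ 86 ∷ 0 ∷ 44 ∷ 45 ∷ 25 ∷ 3 ∷ 15 ∷ 13 ∷ [])) ∷ (# 108 , (27 ∷ 1 ∷ 29 ∷ 22 ∷ 2 ∷ 15 ∷ [])) ∷ (# 109 , (28 ∷ 22 ∷ 29 ∷ 23 ∷ 11 ∷ 12 ∷ 0 ∷ []))
  ∷ (# 110 , (29 ∷ 11 ∷ 32 ∷ 12 ∷ 4 ∷ 5 ∷ 1 ∷ 0 ∷ [])) ∷ (# 111 , (20 ∷ 24 ∷ 26 ∷ 25 ∷ 18 ∷ 21 ∷ 2 ∷ 1 ∷ [])) ∷ (# 112 , (9 ∷ 5 ∷ 8 ∷ 6 ∷ 7 ∷ 4 ∷ 3 ∷ 1 ∷ []))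
  ∷ (# 114 , (22 ∷ 6 ∷ 21 ∷ 20 ∷ 19 ∷ 5 ∷ 4 ∷ 1 ∷ 0 ∷ [])) ∷ (# 113 , (19 ∷ 15 ∷ 18 ∷ 16 ∷ 17 ∷ 13 ∷ 4 ∷ 3 ∷ [])) ∷ (# 115 , (20 ∷ 28 ∷ 27 ∷ 18 ∷ 26 ∷ 25 ∷ 5 ∷ 3 ∷ 0 ∷ []))
  ∷ (# 116 , (13 ∷ 17 ∷ 16 ∷ 11 ∷ 14 ∷ 15 ∷ 5 ∷ 3 ∷ 1 ∷ [])) ∷ (# 23 , (8 ∷ 7 ∷ 6 ∷ 5 ∷ 4 ∷ 2 ∷ 3 ∷ 1 ∷ 0 ∷ [])) ∷ (# 117 , (27 ∷ 34 ∷ 0 ∷ 72 ∷ 24 ∷ 29 ∷ 28 ∷ 6 ∷ 4 ∷ 2 ∷ []))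
  ∷ (# 118 , (16 ∷ 35 ∷ 1 ∷ 37 ∷ 25 ∷ 17 ∷ 11 ∷ 6 ∷ 5 ∷ 2 ∷ 0 ∷ [])) ∷ (# 119 , (25 ∷ 36 ∷ 2 ∷ 37 ∷ 31 ∷ 18 ∷ 19 ∷ 5 ∷ 4 ∷ 3 ∷ 1 ∷ 0 ∷ []))
  ∷ []

finalOrder : List PiV
finalOrder = visit seedOrder stepTable

finalOrder-complete : ∀ v → v ∈ finalOrder
finalOrder-complete = from-yes (all? (_∈? finalOrder))

steps-valid : T (validSteps seedOrder stepTable)
steps-valid = tt

lines : List Line
lines = List.map row (allFin 5) List.++ List.map col (allFin 5)

matchesLine : List (Fin 5) → Line → Bool
matchesLine colours ℓ =
  does (List.≡-dec _≟_ colours (List.map (normalise (lineColour ℓ)) finalOrder))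

-- Opaque so that the search is evaluated here only, never while comparing types below.
opaque
  isCanonical : List (Fin 5) → Bool
  isCanonical colours = any (matchesLine colours) lines

  search-exhaustive : T (explore isCanonical stepTable (3F ∷ 2F ∷ 1F ∷ 0F ∷ []))
  search-exhaustive = tt

  isCanonical-sound : ∀ colours → T (isCanonical colours) →
                      ∃ λ ℓ → colours ≡ List.map (normalise (lineColour ℓ)) finalOrder
  isCanonical-sound colours found =
    let ℓ , matches = satisfied (any⁻ (matchesLine colours) lines found)
    in ℓ , dec-true⁻¹ (List.≡-dec _≟_ colours (List.map (normalise (lineColour ℓ)) finalOrder))
                      (Equivalence.to (T-≡ {matchesLine colours ℓ}) matches)

normalise-isCanonical : ∀ {h} → Proper h → T (isCanonical (List.map (normalise h) finalOrder))
normalise-isCanonical {h} proper =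
  explore-sound {normalise h} (normalise-proper {h} proper)
    isCanonical seedOrder stepTable steps-valid
    (subst (T ∘ explore isCanonical stepTable) (sym (normalise-seed {h} proper)) search-exhaustive)

normalise-canonical : ∀ {h} → Proper h → ∃ λ ℓ → ∀ v → normalise h v ≡ normalise (lineColour ℓ) v
normalise-canonical {h} proper =
  let ℓ , same = isCanonical-sound (List.map (normalise h) finalOrder)
                                   (normalise-isCanonical {h} proper)
  in ℓ , λ v → map-≡-∈ {f = normalise h} {normalise (lineColour ℓ)} {finalOrder}
                       same (finalOrder-complete v)

classes-onLine : (f : FiveColouring Π600) →
                 ∃ λ ℓ → ∀ c → ∃ λ k → class Π600 f c ≗ grid (onLine ℓ k)
classes-onLine (f , _ , proper) =
  let ℓ , same = normalise-canonical {f} proper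
      onℓ = relabelled-classes {f = f} {g = lineColour ℓ} (seedRelabel-injective {f} proper)
                               (seedRelabel-injective {lineColour ℓ} (lineColour-proper ℓ)) same
  in ℓ , λ c → let k , c≗k = onℓ c in k , λ v → trans (c≗k v) (class-onLine ℓ k v)

-- B(Π) is the rook graph

-- The colour classes at distinct cells already differ on these vertices.
witnesses : List (Fin 120)
witnesses = # 0 ∷ # 1 ∷ # 8 ∷ # 9 ∷ # 10 ∷ # 2 ∷ # 12 ∷ # 3 ∷ # 24 ∷ # 29 ∷ # 25 ∷ # 32 ∷ # 27 ∷ []

cells : List Grid
cells = List.cartesianProduct (allFin 5) (allFin 5)

-- Junk value (0, 0) when no cell matches.
locateValues : List Bool → Grid
locateValues values = fromMaybe (0F , 0F)
  (List.find (λ p → List.≡-dec Bool._≟_ values (List.map (grid p) witnesses)) cells)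

locate : Subset Π600 → Grid
locate s = locateValues (List.map s witnesses)

locate-grid : ∀ p → locate (grid p) ≡ p
locate-grid (r , c) =
  from-yes (all? λ r → all? λ c → ×-≡-dec _≟_ _≟_ (locate (grid (r , c))) (r , c)) r c

locate-cong : ∀ {s t} → s ≗ t → locate s ≡ locate t
locate-cong s≗t = cong locateValues (List.map-cong s≗t witnesses)

locate-onGrid : ∀ s p → s ≗ grid p → locate s ≡ p
locate-onGrid s p s≗p = trans (locate-cong {s} {grid p} s≗p) (locate-grid p)

vertex-grid : (x : BV Π600) → ∃ λ p → proj₁ x ≗ grid p
vertex-grid (s , f , c , s≗) =
  let ℓ , onℓ = classes-onLine f
      k , c≗k = onℓ c
  in onLine ℓ k , λ v → trans (s≗ v) (c≗k v)

vertex-onGrid : (x : BV Π600) → proj₁ x ≗ grid (locate (proj₁ x))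
vertex-onGrid x v =
  let p , x≗p = vertex-grid x
  in trans (x≗p v) (cong (λ q → grid q v) (sym (locate-onGrid (proj₁ x) p x≗p)))

gridVertex : Grid → BV Π600
gridVertex p = grid p , lineColouring (row (proj₁ p)) , proj₂ p , λ _ → refl

BΠ-adj⇒rook : ∀ {x y} → Graph.adj (B Π600) x y → Rook (locate (proj₁ x)) (locate (proj₁ y))
BΠ-adj⇒rook {x} {y} (x≉y , f , c , d , x≗c , y≗d) =
  let ℓ , onℓ = classes-onLine f
      k , c≗k = onℓ c
      k′ , d≗k′ = onℓ d
  in distinct ,
     subst₂ SameLine (sym (locate-onGrid (proj₁ x) (onLine ℓ k) (λ v → trans (x≗c v) (c≗k v))))
                     (sym (locate-onGrid (proj₁ y) (onLine ℓ k′) (λ v → trans (y≗d v) (d≗k′ v))))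
                     (onLine-sameLine ℓ k k′)
  where
  distinct : locate (proj₁ x) ≢ locate (proj₁ y)
  distinct eq = x≉y λ v →
    trans (vertex-onGrid x v) (trans (cong (λ q → grid q v) eq) (sym (vertex-onGrid y v)))

onLine-adj : ∀ ℓ {k k′} → onLine ℓ k ≢ onLine ℓ k′ →
             Graph.adj (B Π600) (gridVertex (onLine ℓ k)) (gridVertex (onLine ℓ k′))
onLine-adj ℓ {k} {k′} k≢k′ =
  (λ k≗k′ → k≢k′ (trans (sym (locate-grid (onLine ℓ k)))
                         (locate-onGrid (grid (onLine ℓ k)) (onLine ℓ k′) k≗k′))) ,
  lineColouring ℓ , k , k′ , (λ v → sym (class-onLine ℓ k v)) , (λ v → sym (class-onLine ℓ k′ v))

BΠ-rook⇒adj : ∀ {p q} → Rook p q → Graph.adj (B Π600) (gridVertex p) (gridVertex q)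
BΠ-rook⇒adj {r , c} {_ , _} (p≢q , inj₁ refl) = onLine-adj (row r) p≢q
BΠ-rook⇒adj {r , c} {_ , _} (p≢q , inj₂ refl) = onLine-adj (col c) p≢q

BΠ-rookGraph : RookGraph (B Π600)
BΠ-rookGraph = record
  { position          = locate ∘ proj₁
  ; vertexAt          = gridVertex
  ; position-cong     = λ {x} {y} → locate-cong {proj₁ x} {proj₁ y}
  ; vertexAt-position = vertex-onGrid
  ; position-vertexAt = locate-grid
  ; adj⇒rook          = λ {x} {y} → BΠ-adj⇒rook {x} {y}
  ; rook⇒adj          = λ {p} {q} → BΠ-rook⇒adj {p} {q}
  }

mainTheorem3 : B²Π≅S₅
mainTheorem3 = LatinSquares.B≅S₅ BΠ-rookGraph
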